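{- Let $\widetilde{G}$ be a mixed graph containing a pendant vertex $x$ with neighbour $y$, and put $\widetilde{G}'=\widetilde{G}-x-y$. Then $\widetilde{G}$ is upper-optimal if and only if $y$ does not lie on any mixed cycle of $\widetilde{G}$ and $\widetilde{G}'$ is upper-optimal.
   Context: A mixed graph $\widetilde{G}$ is obtained from a simple graph $G$ by orienting some edges. $H(\widetilde{G})=(h_{uv})$ has $h_{uv}=1$ for an undirected edge $\{u,v\}$, $i$ for an arc $(u,v)$, $-i$ for an arc $(v,u)$, $0$ otherwise; $rk(\widetilde{G})$ is its rank and $r(G)$ is the rank of the adjacency matrix of $G$. $d(G)=|E_G|-|V_G|+\omega(G)$, $\omega(G)$ the number of components. $\widetilde{G}$ is upper-optimal if $rk(\widetilde{G})-r(G)=2d(G)$. A pendant vertex is a vertex of degree one in $G$. $\widetilde{G}-x-y$ is obtained by deleting $x,y$ and incident edges/arcs. -}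

module Defs where

open import Data.Nat as ℕ using (ℕ; zero; suc)
open import Data.Integer as ℤ using (ℤ; +_; -[1+_])
open import Data.Fin using (Fin; zero; suc; toℕ; inject₁; fromℕ; punchIn; punchOut)
open import Data.Bool using (Bool; true; false; if_then_else_)
open import Data.Product using (Σ; ∃; _×_; _,_; Σ-syntax)
open import Data.Empty using (⊥)
open import Relation.Nullary using (¬_)
open import Relation.Binary.PropositionalEquality using (_≡_; refl; cong; sym; trans; subst)
open import Function.Definitions using (Injective; Surjective)
open import Function.Bundles using (_⇔_)

-- Gaussian integers ℤ[i] (entries of H and of A live here; the rank of
-- a matrix over ℤ[i] equals its rank over ℂ, and that of a 0/1 matrix
-- equals its rank over ℝ).

record GI : Set where
  constructor _+i_
  field
    re : ℤ
    im : ℤ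
open GI public

0ᴳ 1ᴳ iᴳ : GI
0ᴳ = (+ 0) +i (+ 0)
1ᴳ = (+ 1) +i (+ 0)
iᴳ = (+ 0) +i (+ 1)

_+ᴳ_ : GI → GI → GI
(a +i b) +ᴳ (c +i d) = (a ℤ.+ c) +i (b ℤ.+ d)

_*ᴳ_ : GI → GI → GI
(a +i b) *ᴳ (c +i d) = ((a ℤ.* c) ℤ.- (b ℤ.* d)) +i ((a ℤ.* d) ℤ.+ (b ℤ.* c))

-ᴳ_ : GI → GI
-ᴳ (a +i b) = (ℤ.- a) +i (ℤ.- b)

sumF : ∀ {k} → (Fin k → GI) → GI
sumF {zero}  f = 0ᴳ
sumF {suc k} f = f zero +ᴳ sumF (λ j → f (suc j))

altSign : ℕ → GI
altSign zero    = 1ᴳ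
altSign (suc n) = -ᴳ altSign n

det : (k : ℕ) → (Fin k → Fin k → GI) → GI
det zero    M = 1ᴳ
det (suc k) M =
  sumF (λ j → (altSign (toℕ j) *ᴳ M zero j)
                *ᴳ det k (λ r c → M (suc r) (punchIn j c)))

Matrix : ℕ → Set
Matrix n = Fin n → Fin n → GI

minor : ∀ {n} → Matrix n → (k : ℕ) → (Fin k → Fin n) → (Fin k → Fin n) → GI
minor M k ρ γ = det k (λ i j → M (ρ i) (γ j))

HasRank : ∀ {n} → Matrix n → ℕ → Set
HasRank {n} M r =
  (Σ[ ρ ∈ (Fin r → Fin n) ] Σ[ γ ∈ (Fin r → Fin n) ]
     Injective _≡_ _≡_ ρ × Injective _≡_ _≡_ γ × ¬ (minor M r ρ γ ≡ 0ᴳ))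
  × (∀ k → r ℕ.< k → (ρ γ : Fin k → Fin n) →
       Injective _≡_ _≡_ ρ → Injective _≡_ _≡_ γ → minor M k ρ γ ≡ 0ᴳ)

-- Mixed graphs on vertex set Fin n.
-- e u v = none : no edge; undirected : undirected edge {u,v};
-- forward : arc (u,v); backward : arc (v,u).

data EdgeKind : Set where
  none undirected forward backward : EdgeKind

reverseKind : EdgeKind → EdgeKind
reverseKind none       = none
reverseKind undirected = undirected
reverseKind forward    = backward
reverseKind backward   = forward

record MixedGraph (n : ℕ) : Set where
  field
    edge     : Fin n → Fin n → EdgeKind
    loopless : ∀ u → edge u u ≡ none
    symm     : ∀ u v → edge v u ≡ reverseKind (edge u v)
open MixedGraph public

Adj : ∀ {n} → MixedGraph n → Fin n → Fin n → Set
Adj G u v = ¬ (edge G u v ≡ none)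

isEdge : EdgeKind → Bool
isEdge none = false
isEdge _    = true

hEntry : EdgeKind → GI
hEntry none       = 0ᴳ
hEntry undirected = 1ᴳ
hEntry forward    = iᴳ
hEntry backward   = -ᴳ iᴳ

H : ∀ {n} → MixedGraph n → Matrix n
H G u v = hEntry (edge G u v)

A : ∀ {n} → MixedGraph n → Matrix n
A G u v = if isEdge (edge G u v) then 1ᴳ else 0ᴳ

sumℕ : ∀ {k} → (Fin k → ℕ) → ℕ
sumℕ {zero}  f = 0
sumℕ {suc k} f = f zero ℕ.+ sumℕ (λ j → f (suc j))

numEdges : ∀ {n} → MixedGraph n → ℕ
numEdges G = sumℕ (λ u → sumℕ (λ v →
  if (toℕ u ℕ.<ᵇ toℕ v) then (if isEdge (edge G u v) then 1 else 0) else 0))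

data Reach {n} (G : MixedGraph n) : Fin n → Fin n → Set where
  here : ∀ {u} → Reach G u u
  step : ∀ {u w v} → Adj G u w → Reach G w v → Reach G u v

ComponentCount : ∀ {n} → MixedGraph n → ℕ → Set
ComponentCount {n} G c =
  Σ[ f ∈ (Fin n → Fin c) ] Surjective _≡_ _≡_ f ×
    (∀ u v → (f u ≡ f v) ⇔ Reach G u v)

UpperOptimal : ∀ {n} → MixedGraph n → Set
UpperOptimal {n} G =
  Σ[ rk ∈ ℕ ] Σ[ r ∈ ℕ ] Σ[ ω ∈ ℕ ]
    HasRank (H G) rk × HasRank (A G) r × ComponentCount G ω ×
    ((+ rk) ℤ.- (+ r) ≡ (+ 2) ℤ.* (((+ numEdges G) ℤ.- (+ n)) ℤ.+ (+ ω)))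

-- y lies on a (mixed) cycle of G̃: a cycle of length ≥ 3 in G through y
OnCycle : ∀ {n} → MixedGraph n → Fin n → Set
OnCycle {n} G y =
  Σ[ m ∈ ℕ ] Σ[ c ∈ (Fin (suc (suc (suc m))) → Fin n) ]
    Injective _≡_ _≡_ c ×
    (∀ (i : Fin (suc (suc m))) → Adj G (c (inject₁ i)) (c (suc i))) ×
    Adj G (c (fromℕ (suc (suc m)))) (c zero) ×
    (Σ[ i ∈ Fin (suc (suc (suc m))) ] c i ≡ y)

deleteVertex : ∀ {n} → MixedGraph (suc n) → Fin (suc n) → MixedGraph n
deleteVertex G x = record
  { edge     = λ u v → edge G (punchIn x u) (punchIn x v)
  ; loopless = λ u → loopless G (punchIn x u)
  ; symm     = λ u v → symm G (punchIn x u) (punchIn x v)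
  }

adj⇒≢ : ∀ {n} (G : MixedGraph n) {x y} → Adj G x y → ¬ (x ≡ y)
adj⇒≢ G {x} a refl = a (loopless G x)

deleteTwo : ∀ {n} → MixedGraph (suc (suc n)) → (x y : Fin (suc (suc n))) →
            ¬ (x ≡ y) → MixedGraph n
deleteTwo G x y x≢y = deleteVertex (deleteVertex G x) (punchOut x≢y)

{-# OPTIONS --safe #-}
module Submission where

-- Deleting the pendant vertex x and its neighbour y lowers both rk(H) and r(A) by exactly two:
-- row and column x have a single nonzero entry, a unit, so expanding along them strips rows
-- and columns x and y off every maximal nonzero minor.  The edge count drops by deg y + 1
-- (deg y taken in G − x), and adding back the edges of y to G′ one at a time merges
-- components, except that an edge closing a cycle through y does not.  Hence d(G) = d(G′)
-- when y lies on no cycle, and d(G) > d(G′) otherwise.  In the first case G and G′ are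
-- upper-optimal together; in the second G is not, because every mixed graph satisfies
-- rk(H) − r(A) ≤ 2 d(G), proved by induction deleting a vertex on a cycle, an isolated
-- vertex, or a pendant vertex with its neighbour.

open import Defs

open import Algebra.Bundles using (CommutativeRing)
open import Algebra.Structures using (IsCommutativeRing)
import Algebra.Properties.Ring as RingProperties
import Algebra.Properties.CommutativeSemigroup as CommutativeSemigroupProperties
open import Data.Bool using (Bool; true; false; if_then_else_)
open import Data.Empty using (⊥-elim)
open import Data.Fin using (Fin; zero; suc; punchIn; punchOut; toℕ; inject₁; fromℕ)
import Data.Fin.Properties as FP
open import Data.Fin.Relation.Unary.Top using (view; ‵fromℕ; ‵inject₁)
import Data.Integer as ℤ
import Data.Integer.Properties as ℤP
import Data.Integer.Tactic.RingSolver as ℤSolver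
open import Data.List as List using (List; []; _∷_; length)
import Data.List.Properties as LP
open import Data.List.Membership.Propositional using (_∈_; _∉_)
open import Data.List.Membership.Propositional.Properties using (∈-map⁺; ∈-map⁻)
open import Data.List.Relation.Unary.Any using (here; there)
import Data.List.Relation.Unary.All as All
import Data.List.Relation.Unary.All.Properties as AllProps
open import Data.List.Relation.Unary.AllPairs using ([]; _∷_)
open import Data.List.Relation.Unary.Unique.Propositional using (Unique)
import Data.List.Relation.Unary.Unique.Propositional.Properties as UniqueProps
open import Data.Nat as ℕ using (ℕ; zero; suc; _<_; _≤_; z≤n; s≤s; _+_; _*_; _∸_)
import Data.Nat.Properties as ℕP
open import Data.Nat.Induction using (<-rec)
open import Data.Nat.Tactic.RingSolver using (solve-∀)
open import Data.Product using (_×_; _,_; Σ-syntax; proj₁; proj₂)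
open import Data.Sum as Sum using (_⊎_; inj₁; inj₂; [_,_]′)
open import Data.Unit using (tt)
import Data.Vec.Functional as Vec
open import Function.Base using (id; _∘_; case_of_)
open import Function.Bundles using (_⇔_; mk⇔; Equivalence)
open import Function.Construct.Composition using (_⇔-∘_)
open import Function.Construct.Symmetry using (⇔-sym)
open import Function.Definitions using (Injective; Surjective)
open import Level using (0ℓ)
open import Relation.Binary.Core using (Rel; _⇒_)
open import Relation.Binary.Construct.Closure.ReflexiveTransitive as Star using (Star; ε; _◅_; _◅◅_)
open import Relation.Binary.Definitions using (DecidableEquality)
open import Relation.Binary.PropositionalEquality
open import Relation.Binary.PropositionalEquality.Algebra using (isMagma)
open import Relation.Nullary using (¬_; Dec; yes; no)
open import Relation.Nullary.Decidable using (_×-dec_; ¬?; map′; decidable-stable)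
open import Relation.Unary using (Pred; U; _∩_; _⊆_)

open import Algebra.Definitions (_≡_ {A = GI})
  using (Associative; Commutative; LeftIdentity; RightIdentity; LeftInverse; RightInverse;
         _DistributesOverˡ_; _DistributesOverʳ_; LeftInvertible)

-- Gaussian integers

_≟ᴳ_ : DecidableEquality GI
(a +i b) ≟ᴳ (c +i d) =
  map′ (λ (p , q) → cong₂ _+i_ p q) (λ e → cong re e , cong im e) ((a ℤ.≟ c) ×-dec (b ℤ.≟ d))

+ᴳ-assoc : Associative _+ᴳ_
+ᴳ-assoc (a +i b) (c +i d) (e +i f) = cong₂ _+i_ (ℤP.+-assoc a c e) (ℤP.+-assoc b d f)

+ᴳ-comm : Commutative _+ᴳ_
+ᴳ-comm (a +i b) (c +i d) = cong₂ _+i_ (ℤP.+-comm a c) (ℤP.+-comm b d)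

+ᴳ-identityˡ : LeftIdentity 0ᴳ _+ᴳ_
+ᴳ-identityˡ (a +i b) = cong₂ _+i_ (ℤP.+-identityˡ a) (ℤP.+-identityˡ b)

+ᴳ-identityʳ : RightIdentity 0ᴳ _+ᴳ_
+ᴳ-identityʳ (a +i b) = cong₂ _+i_ (ℤP.+-identityʳ a) (ℤP.+-identityʳ b)

-ᴳ-inverseˡ : LeftInverse 0ᴳ -ᴳ_ _+ᴳ_
-ᴳ-inverseˡ (a +i b) = cong₂ _+i_ (ℤP.+-inverseˡ a) (ℤP.+-inverseˡ b)

-ᴳ-inverseʳ : RightInverse 0ᴳ -ᴳ_ _+ᴳ_
-ᴳ-inverseʳ (a +i b) = cong₂ _+i_ (ℤP.+-inverseʳ a) (ℤP.+-inverseʳ b)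

*ᴳ-comm : Commutative _*ᴳ_
*ᴳ-comm (a +i b) (c +i d) = cong₂ _+i_ (re-comm a b c d) (im-comm a b c d)
  where
  re-comm : ∀ a b c d → a ℤ.* c ℤ.- b ℤ.* d ≡ c ℤ.* a ℤ.- d ℤ.* b
  re-comm = ℤSolver.solve-∀
  im-comm : ∀ a b c d → a ℤ.* d ℤ.+ b ℤ.* c ≡ c ℤ.* b ℤ.+ d ℤ.* a
  im-comm = ℤSolver.solve-∀

*ᴳ-assoc : Associative _*ᴳ_
*ᴳ-assoc (a +i b) (c +i d) (e +i f) = cong₂ _+i_ (re-assoc a b c d e f) (im-assoc a b c d e f)
  where
  re-assoc : ∀ a b c d e f → (a ℤ.* c ℤ.- b ℤ.* d) ℤ.* e ℤ.- (a ℤ.* d ℤ.+ b ℤ.* c) ℤ.* f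
                           ≡ a ℤ.* (c ℤ.* e ℤ.- d ℤ.* f) ℤ.- b ℤ.* (c ℤ.* f ℤ.+ d ℤ.* e)
  re-assoc = ℤSolver.solve-∀
  im-assoc : ∀ a b c d e f → (a ℤ.* c ℤ.- b ℤ.* d) ℤ.* f ℤ.+ (a ℤ.* d ℤ.+ b ℤ.* c) ℤ.* e
                           ≡ a ℤ.* (c ℤ.* f ℤ.+ d ℤ.* e) ℤ.+ b ℤ.* (c ℤ.* e ℤ.- d ℤ.* f)
  im-assoc = ℤSolver.solve-∀

*ᴳ-identityˡ : LeftIdentity 1ᴳ _*ᴳ_
*ᴳ-identityˡ (a +i b) = cong₂ _+i_ (re-identity a b) (im-identity a b)
  where
  re-identity : ∀ a b → ℤ.+ 1 ℤ.* a ℤ.- ℤ.+ 0 ℤ.* b ≡ a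
  re-identity = ℤSolver.solve-∀
  im-identity : ∀ a b → ℤ.+ 1 ℤ.* b ℤ.+ ℤ.+ 0 ℤ.* a ≡ b
  im-identity = ℤSolver.solve-∀

*ᴳ-identityʳ : RightIdentity 1ᴳ _*ᴳ_
*ᴳ-identityʳ x = trans (*ᴳ-comm x 1ᴳ) (*ᴳ-identityˡ x)

*ᴳ-distribˡ-+ᴳ : _*ᴳ_ DistributesOverˡ _+ᴳ_
*ᴳ-distribˡ-+ᴳ (a +i b) (c +i d) (e +i f) = cong₂ _+i_ (re-distrib a b c d e f) (im-distrib a b c d e f)
  where
  re-distrib : ∀ a b c d e f → a ℤ.* (c ℤ.+ e) ℤ.- b ℤ.* (d ℤ.+ f)
                             ≡ (a ℤ.* c ℤ.- b ℤ.* d) ℤ.+ (a ℤ.* e ℤ.- b ℤ.* f)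
  re-distrib = ℤSolver.solve-∀
  im-distrib : ∀ a b c d e f → a ℤ.* (d ℤ.+ f) ℤ.+ b ℤ.* (c ℤ.+ e)
                             ≡ (a ℤ.* d ℤ.+ b ℤ.* c) ℤ.+ (a ℤ.* f ℤ.+ b ℤ.* e)
  im-distrib = ℤSolver.solve-∀

*ᴳ-distribʳ-+ᴳ : _*ᴳ_ DistributesOverʳ _+ᴳ_
*ᴳ-distribʳ-+ᴳ x y z =
  trans (*ᴳ-comm (y +ᴳ z) x) (trans (*ᴳ-distribˡ-+ᴳ x y z) (cong₂ _+ᴳ_ (*ᴳ-comm x y) (*ᴳ-comm x z)))

+ᴳ-*ᴳ-isCommutativeRing : IsCommutativeRing _≡_ _+ᴳ_ _*ᴳ_ -ᴳ_ 0ᴳ 1ᴳ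
+ᴳ-*ᴳ-isCommutativeRing = record
  { isRing = record
    { +-isAbelianGroup = record
      { isGroup = record
        { isMonoid = record
          { isSemigroup = record { isMagma = isMagma _+ᴳ_ ; assoc = +ᴳ-assoc }
          ; identity = +ᴳ-identityˡ , +ᴳ-identityʳ
          }
        ; inverse = -ᴳ-inverseˡ , -ᴳ-inverseʳ
        ; ⁻¹-cong = cong -ᴳ_
        }
      ; comm = +ᴳ-comm
      }
    ; *-cong = cong₂ _*ᴳ_
    ; *-assoc = *ᴳ-assoc
    ; *-identity = *ᴳ-identityˡ , *ᴳ-identityʳ
    ; distrib = *ᴳ-distribˡ-+ᴳ , *ᴳ-distribʳ-+ᴳ
    }
  ; *-comm = *ᴳ-comm
  }

+ᴳ-*ᴳ-commutativeRing : CommutativeRing 0ℓ 0ℓ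
+ᴳ-*ᴳ-commutativeRing = record { isCommutativeRing = +ᴳ-*ᴳ-isCommutativeRing }

module GIRing = CommutativeRing +ᴳ-*ᴳ-commutativeRing
module GIProperties = RingProperties GIRing.ring

+ᴳ-interchange : ∀ a b c d → (a +ᴳ b) +ᴳ (c +ᴳ d) ≡ (a +ᴳ c) +ᴳ (b +ᴳ d)
+ᴳ-interchange = CommutativeSemigroupProperties.interchange GIRing.+-commutativeSemigroup

*ᴳ-interchange : ∀ a b c d → (a *ᴳ b) *ᴳ (c *ᴳ d) ≡ (a *ᴳ c) *ᴳ (b *ᴳ d)
*ᴳ-interchange = CommutativeSemigroupProperties.interchange GIRing.*-commutativeSemigroup

x*y≢0⇒x≢0 : ∀ x y → x *ᴳ y ≢ 0ᴳ → x ≢ 0ᴳ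
x*y≢0⇒x≢0 x y xy≢0 refl = xy≢0 (GIRing.zeroˡ y)

x*y≢0⇒y≢0 : ∀ x y → x *ᴳ y ≢ 0ᴳ → y ≢ 0ᴳ
x*y≢0⇒y≢0 x y xy≢0 refl = xy≢0 (GIRing.zeroʳ x)

IsUnit : GI → Set
IsUnit = LeftInvertible 1ᴳ _*ᴳ_

1-isUnit : IsUnit 1ᴳ
1-isUnit = 1ᴳ , refl

i-isUnit : IsUnit iᴳ
i-isUnit = -ᴳ iᴳ , refl

-i-isUnit : IsUnit (-ᴳ iᴳ)
-i-isUnit = iᴳ , refl

unit*x≡0⇒x≡0 : ∀ {u} → IsUnit u → ∀ x → u *ᴳ x ≡ 0ᴳ → x ≡ 0ᴳ
unit*x≡0⇒x≡0 {u} (v , vu≡1) x ux≡0 = begin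
  x                ≡⟨ sym (*ᴳ-identityˡ x) ⟩
  1ᴳ *ᴳ x          ≡⟨ cong (_*ᴳ x) (sym vu≡1) ⟩
  (v *ᴳ u) *ᴳ x    ≡⟨ *ᴳ-assoc v u x ⟩
  v *ᴳ (u *ᴳ x)    ≡⟨ cong (v *ᴳ_) ux≡0 ⟩
  v *ᴳ 0ᴳ          ≡⟨ GIRing.zeroʳ v ⟩
  0ᴳ               ∎
  where open ≡-Reasoning

altSign-+ : ∀ m n → altSign (m + n) ≡ altSign m *ᴳ altSign n
altSign-+ zero    n = sym (*ᴳ-identityˡ (altSign n))
altSign-+ (suc m) n = trans (cong -ᴳ_ (altSign-+ m n)) (GIProperties.-‿distribˡ-* (altSign m) (altSign n))

altSign-2+ : ∀ n → altSign (2 + n) ≡ altSign n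
altSign-2+ n = GIProperties.-‿involutive (altSign n)

sumF-cong : ∀ {k} {f g : Fin k → GI} → (∀ i → f i ≡ g i) → sumF f ≡ sumF g
sumF-cong {zero}  f≗g = refl
sumF-cong {suc k} f≗g = cong₂ _+ᴳ_ (f≗g zero) (sumF-cong (λ i → f≗g (suc i)))

sumF-zero : ∀ {k} {f : Fin k → GI} → (∀ i → f i ≡ 0ᴳ) → sumF f ≡ 0ᴳ
sumF-zero {zero}  f≗0 = refl
sumF-zero {suc k} f≗0 = cong₂ _+ᴳ_ (f≗0 zero) (sumF-zero (λ i → f≗0 (suc i)))

sumF-+ : ∀ {k} (f g : Fin k → GI) → sumF (λ i → f i +ᴳ g i) ≡ sumF f +ᴳ sumF g
sumF-+ {zero}  f g = refl
sumF-+ {suc k} f g = trans (cong ((f zero +ᴳ g zero) +ᴳ_) (sumF-+ (λ i → f (suc i)) (λ i → g (suc i))))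
                           (+ᴳ-interchange (f zero) (g zero) _ _)

*ᴳ-distribˡ-sumF : ∀ {k} a (f : Fin k → GI) → a *ᴳ sumF f ≡ sumF (λ i → a *ᴳ f i)
*ᴳ-distribˡ-sumF {zero}  a f = GIRing.zeroʳ a
*ᴳ-distribˡ-sumF {suc k} a f =
  trans (*ᴳ-distribˡ-+ᴳ a _ _) (cong ((a *ᴳ f zero) +ᴳ_) (*ᴳ-distribˡ-sumF a (λ i → f (suc i))))

sumF-comm : ∀ {k l} (f : Fin k → Fin l → GI) →
  sumF (λ i → sumF (f i)) ≡ sumF (λ j → sumF (λ i → f i j))
sumF-comm {zero}  f = sym (sumF-zero (λ _ → refl))
sumF-comm {suc k} f = begin
  sumF (f zero) +ᴳ sumF (λ i → sumF (f (suc i)))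
    ≡⟨ cong (sumF (f zero) +ᴳ_) (sumF-comm (λ i → f (suc i))) ⟩
  sumF (f zero) +ᴳ sumF (λ j → sumF (λ i → f (suc i) j))
    ≡⟨ sym (sumF-+ (f zero) (λ j → sumF (λ i → f (suc i) j))) ⟩
  sumF (λ j → sumF (λ i → f i j)) ∎
  where open ≡-Reasoning

sumF-punchIn : ∀ {k} (f : Fin (suc k) → GI) c → sumF f ≡ f c +ᴳ sumF (λ j → f (punchIn c j))
sumF-punchIn         f zero    = refl
sumF-punchIn {suc k} f (suc c) = begin
  f zero +ᴳ sumF (λ j → f (suc j))
    ≡⟨ cong (f zero +ᴳ_) (sumF-punchIn (λ j → f (suc j)) c) ⟩
  f zero +ᴳ (f (suc c) +ᴳ rest)
    ≡⟨ CommutativeSemigroupProperties.x∙yz≈y∙xz GIRing.+-commutativeSemigroup (f zero) (f (suc c)) rest ⟩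
  f (suc c) +ᴳ (f zero +ᴳ rest) ∎
  where
  open ≡-Reasoning
  rest = sumF (λ j → f (suc (punchIn c j)))

sumF-single : ∀ {k} (f : Fin (suc k) → GI) c → (∀ j → f (punchIn c j) ≡ 0ᴳ) → sumF f ≡ f c
sumF-single f c others≡0 =
  trans (sumF-punchIn f c) (trans (cong (f c +ᴳ_) (sumF-zero others≡0)) (+ᴳ-identityʳ (f c)))

sumF≢0⇒term≢0 : ∀ {k} (f : Fin k → GI) → sumF f ≢ 0ᴳ → Σ[ i ∈ Fin k ] f i ≢ 0ᴳ
sumF≢0⇒term≢0 {zero}  f sum≢0 = ⊥-elim (sum≢0 refl)
sumF≢0⇒term≢0 {suc k} f sum≢0 with f zero ≟ᴳ 0ᴳ
... | no  f0≢0 = zero , f0≢0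
... | yes f0≡0 with sumF≢0⇒term≢0 (λ i → f (suc i)) (λ rest≡0 → sum≢0 (cong₂ _+ᴳ_ f0≡0 rest≡0))
...   | i , fi≢0 = suc i , fi≢0

-- Determinants

strike : ∀ {k} → Matrix (suc k) → Fin (suc k) → Fin (suc k) → Matrix k
strike N i j r s = N (punchIn i r) (punchIn j s)

transpose : ∀ {k} → Matrix k → Matrix k
transpose N i j = N j i

-- det (suc k) N unfolds to sumF (laplaceTerm N zero).
laplaceTerm : ∀ {k} → Matrix (suc k) → Fin (suc k) → Fin (suc k) → GI
laplaceTerm {k} N i j = (altSign (toℕ i + toℕ j) *ᴳ N i j) *ᴳ det k (strike N i j)

det-cong : ∀ k {N N′ : Matrix k} → (∀ i j → N i j ≡ N′ i j) → det k N ≡ det k N′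
det-cong zero    N≗N′ = refl
det-cong (suc k) N≗N′ = sumF-cong (λ j →
  cong₂ _*ᴳ_ (cong (altSign (toℕ j) *ᴳ_) (N≗N′ zero j)) (det-cong k (λ r s → N≗N′ (suc r) (punchIn j s))))

punchIn-punchIn-punchOut : ∀ {m} (c : Fin (suc (suc m))) j (c⁺≢c : punchIn c j ≢ c) (s : Fin m) →
  punchIn (punchIn c j) (punchIn (punchOut c⁺≢c) s) ≡ punchIn c (punchIn j s)
punchIn-punchIn-punchOut zero          j       c⁺≢c s       = refl
punchIn-punchIn-punchOut {suc m} (suc c) zero    c⁺≢c s       = refl
punchIn-punchIn-punchOut {suc m} (suc c) (suc j) c⁺≢c zero    = refl
punchIn-punchIn-punchOut {suc m} (suc c) (suc j) c⁺≢c (suc s) =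
  cong suc (punchIn-punchIn-punchOut c j (λ e → c⁺≢c (cong suc e)) s)

-- Column c sits at position punchOut c⁺≢c once column c⁺ = punchIn c j is struck, and
-- column c⁺ at position j once column c is struck: the two signs differ by exactly one.
altSign-punchIn-punchOut : ∀ {m} (c : Fin (suc (suc m))) j (c⁺≢c : punchIn c j ≢ c) →
  altSign (toℕ (punchIn c j) + toℕ (punchOut c⁺≢c)) ≡ altSign (suc (toℕ c + toℕ j))
altSign-punchIn-punchOut zero j c⁺≢c = cong (λ t → altSign (suc t)) (ℕP.+-identityʳ (toℕ j))
altSign-punchIn-punchOut (suc c) zero c⁺≢c =
  sym (trans (altSign-2+ (toℕ c + 0)) (cong altSign (ℕP.+-identityʳ (toℕ c))))
altSign-punchIn-punchOut {suc m} (suc c) (suc j) c⁺≢c = begin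
  altSign (suc (toℕ (punchIn c j)) + suc (toℕ (punchOut c⁺≢c′)))
    ≡⟨ cong (λ t → altSign (suc t)) (ℕP.+-suc (toℕ (punchIn c j)) _) ⟩
  altSign (2 + (toℕ (punchIn c j) + toℕ (punchOut c⁺≢c′)))
    ≡⟨ altSign-2+ (toℕ (punchIn c j) + toℕ (punchOut c⁺≢c′)) ⟩
  altSign (toℕ (punchIn c j) + toℕ (punchOut c⁺≢c′))
    ≡⟨ altSign-punchIn-punchOut c j c⁺≢c′ ⟩
  altSign (suc (toℕ c + toℕ j))
    ≡⟨ sym (altSign-2+ (suc (toℕ c + toℕ j))) ⟩
  altSign (2 + suc (toℕ c + toℕ j))
    ≡⟨ cong (λ t → altSign (suc (suc t))) (sym (ℕP.+-suc (toℕ c) (toℕ j))) ⟩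
  altSign (suc (suc (toℕ c + suc (toℕ j)))) ∎
  where
  open ≡-Reasoning
  c⁺≢c′ = λ e → c⁺≢c (cong suc e)

*ᴳ-regroup : ∀ a b c d x y D → a *ᴳ b ≡ c *ᴳ d →
  (a *ᴳ x) *ᴳ ((b *ᴳ y) *ᴳ D) ≡ (c *ᴳ y) *ᴳ ((d *ᴳ x) *ᴳ D)
*ᴳ-regroup a b c d x y D ab≡cd = begin
  (a *ᴳ x) *ᴳ ((b *ᴳ y) *ᴳ D)   ≡⟨ sym (*ᴳ-assoc (a *ᴳ x) (b *ᴳ y) D) ⟩
  ((a *ᴳ x) *ᴳ (b *ᴳ y)) *ᴳ D   ≡⟨ cong (_*ᴳ D) (*ᴳ-interchange a x b y) ⟩
  ((a *ᴳ b) *ᴳ (x *ᴳ y)) *ᴳ D   ≡⟨ cong (_*ᴳ D) (cong₂ _*ᴳ_ ab≡cd (*ᴳ-comm x y)) ⟩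
  ((c *ᴳ d) *ᴳ (y *ᴳ x)) *ᴳ D   ≡⟨ cong (_*ᴳ D) (*ᴳ-interchange c d y x) ⟩
  ((c *ᴳ y) *ᴳ (d *ᴳ x)) *ᴳ D   ≡⟨ *ᴳ-assoc (c *ᴳ y) (d *ᴳ x) D ⟩
  (c *ᴳ y) *ᴳ ((d *ᴳ x) *ᴳ D)   ∎
  where open ≡-Reasoning

-- Expand along row 0 and then every cofactor along column c, and compare with the
-- expansion along column c followed by row 0.
det-expandColumn : ∀ k (N : Matrix (suc k)) c → det (suc k) N ≡ sumF (λ i → laplaceTerm N i c)
det-expandColumn zero    N zero = refl
det-expandColumn (suc k) N c    = begin
  sumF (laplaceTerm N zero)
    ≡⟨ sumF-punchIn (laplaceTerm N zero) c ⟩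
  laplaceTerm N zero c +ᴳ sumF (λ j → laplaceTerm N zero (punchIn c j))
    ≡⟨ cong (laplaceTerm N zero c +ᴳ_) (sumF-cong rowFirst) ⟩
  laplaceTerm N zero c +ᴳ sumF (λ j → sumF (rowThenColumn j))
    ≡⟨ cong (laplaceTerm N zero c +ᴳ_) (sumF-comm rowThenColumn) ⟩
  laplaceTerm N zero c +ᴳ sumF (λ i → sumF (λ j → rowThenColumn j i))
    ≡⟨ cong (laplaceTerm N zero c +ᴳ_) (sumF-cong (λ i → sumF-cong (λ j → bothOrders j i))) ⟩
  laplaceTerm N zero c +ᴳ sumF (λ i → sumF (columnThenRow i))
    ≡⟨ cong (laplaceTerm N zero c +ᴳ_) (sumF-cong (λ i → sym (columnFirst i))) ⟩
  sumF (λ i → laplaceTerm N i c) ∎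
  where
  open ≡-Reasoning
  c′ : Fin (suc k) → Fin (suc k)
  c′ j = punchOut (FP.punchInᵢ≢i c j)
  rowThenColumn : Fin (suc k) → Fin (suc k) → GI
  rowThenColumn j i = (altSign (toℕ (punchIn c j)) *ᴳ N zero (punchIn c j)) *ᴳ
                      laplaceTerm (strike N zero (punchIn c j)) i (c′ j)
  columnThenRow : Fin (suc k) → Fin (suc k) → GI
  columnThenRow i j = (altSign (suc (toℕ i) + toℕ c) *ᴳ N (suc i) c) *ᴳ
                      ((altSign (toℕ j) *ᴳ N zero (punchIn c j)) *ᴳ det k (strike (strike N (suc i) c) zero j))
  rowFirst : ∀ j → laplaceTerm N zero (punchIn c j) ≡ sumF (rowThenColumn j)
  rowFirst j = trans (cong (entry *ᴳ_) (det-expandColumn k (strike N zero (punchIn c j)) (c′ j)))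
                     (*ᴳ-distribˡ-sumF entry (λ i → laplaceTerm (strike N zero (punchIn c j)) i (c′ j)))
    where entry = altSign (toℕ (punchIn c j)) *ᴳ N zero (punchIn c j)
  columnFirst : ∀ i → laplaceTerm N (suc i) c ≡ sumF (columnThenRow i)
  columnFirst i = *ᴳ-distribˡ-sumF (altSign (suc (toℕ i) + toℕ c) *ᴳ N (suc i) c)
    (λ j → (altSign (toℕ j) *ᴳ N zero (punchIn c j)) *ᴳ det k (strike (strike N (suc i) c) zero j))
  signs : ∀ j i → altSign (toℕ (punchIn c j)) *ᴳ altSign (toℕ i + toℕ (c′ j))
                ≡ altSign (suc (toℕ i) + toℕ c) *ᴳ altSign (toℕ j)
  signs j i = begin
    altSign a *ᴳ altSign (toℕ i + b)       ≡⟨ sym (altSign-+ a _) ⟩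
    altSign (a + (toℕ i + b))              ≡⟨ cong altSign (swap a (toℕ i) b) ⟩
    altSign (toℕ i + (a + b))              ≡⟨ altSign-+ (toℕ i) _ ⟩
    altSign (toℕ i) *ᴳ altSign (a + b)     ≡⟨ cong (altSign (toℕ i) *ᴳ_) (altSign-punchIn-punchOut c j _) ⟩
    altSign (toℕ i) *ᴳ altSign (suc (toℕ c + toℕ j))  ≡⟨ sym (altSign-+ (toℕ i) _) ⟩
    altSign (toℕ i + suc (toℕ c + toℕ j))  ≡⟨ cong altSign (reassoc (toℕ i) (toℕ c) (toℕ j)) ⟩
    altSign ((suc (toℕ i) + toℕ c) + toℕ j) ≡⟨ altSign-+ (suc (toℕ i) + toℕ c) (toℕ j) ⟩
    altSign (suc (toℕ i) + toℕ c) *ᴳ altSign (toℕ j) ∎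
    where
    a = toℕ (punchIn c j)
    b = toℕ (c′ j)
    swap : ∀ a i b → a + (i + b) ≡ i + (a + b)
    swap = solve-∀
    reassoc : ∀ i c j → i + suc (c + j) ≡ (suc i + c) + j
    reassoc = solve-∀
  bothOrders : ∀ j i → rowThenColumn j i ≡ columnThenRow i j
  bothOrders j i = trans
    (cong₂ (λ e D → (altSign (toℕ (punchIn c j)) *ᴳ N zero (punchIn c j)) *ᴳ
                      ((altSign (toℕ i + toℕ (c′ j)) *ᴳ N (suc i) e) *ᴳ D))
           (FP.punchIn-punchOut (FP.punchInᵢ≢i c j))
           (det-cong k (λ r s → cong (N (suc (punchIn i r))) (punchIn-punchIn-punchOut c j _ s))))
    (*ᴳ-regroup (altSign (toℕ (punchIn c j))) (altSign (toℕ i + toℕ (c′ j)))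
                (altSign (suc (toℕ i) + toℕ c)) (altSign (toℕ j))
                (N zero (punchIn c j)) (N (suc i) c) (det k (strike (strike N (suc i) c) zero j)) (signs j i))

det-transpose : ∀ k (N : Matrix k) → det k (transpose N) ≡ det k N
det-transpose zero    N = refl
det-transpose (suc k) N = begin
  det (suc k) (transpose N)
    ≡⟨ sumF-cong (λ j → cong₂ _*ᴳ_ (cong (λ t → altSign t *ᴳ N j zero) (sym (ℕP.+-identityʳ (toℕ j))))
                                    (det-transpose k (strike N j zero))) ⟩
  sumF (λ i → laplaceTerm N i zero)
    ≡⟨ sym (det-expandColumn k N zero) ⟩
  det (suc k) N ∎
  where open ≡-Reasoning

det-expandRow : ∀ k (N : Matrix (suc k)) p → det (suc k) N ≡ sumF (laplaceTerm N p)
det-expandRow k N p = begin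
  det (suc k) N                                ≡⟨ sym (det-transpose (suc k) N) ⟩
  det (suc k) (transpose N)                    ≡⟨ det-expandColumn k (transpose N) p ⟩
  sumF (λ j → laplaceTerm (transpose N) j p)
    ≡⟨ sumF-cong (λ j → cong₂ _*ᴳ_ (cong (λ t → altSign t *ᴳ N p j) (ℕP.+-comm (toℕ j) (toℕ p)))
                                    (det-transpose k (strike N p j))) ⟩
  sumF (laplaceTerm N p)                       ∎
  where open ≡-Reasoning

-- Minors and rank

submatrix : ∀ {k n} → Matrix n → (Fin k → Fin n) → (Fin k → Fin n) → Matrix k
submatrix M ρ γ i j = M (ρ i) (γ j)

restrict : ∀ {m n} → Matrix n → (Fin m → Fin n) → Matrix m
restrict M e = submatrix M e e

record NonzeroMinorIn {n} (M : Matrix n) (k : ℕ) (P Q : Pred (Fin n) 0ℓ) : Set where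
  constructor nonzeroMinor
  field
    rows cols      : Fin k → Fin n
    rows-injective : Injective _≡_ _≡_ rows
    cols-injective : Injective _≡_ _≡_ cols
    rows∈P         : ∀ i → P (rows i)
    cols∈Q         : ∀ j → Q (cols j)
    minor≢0        : minor M k rows cols ≢ 0ᴳ

NonzeroMinor : ∀ {n} → Matrix n → ℕ → Set
NonzeroMinor M k = NonzeroMinorIn M k U U

laplaceTerm≢0 : ∀ {k} (N : Matrix (suc k)) i j → laplaceTerm N i j ≢ 0ᴳ →
  N i j ≢ 0ᴳ × det k (strike N i j) ≢ 0ᴳ
laplaceTerm≢0 {k} N i j term≢0 =
  x*y≢0⇒y≢0 sign (N i j) (x*y≢0⇒x≢0 (sign *ᴳ N i j) (det k (strike N i j)) term≢0) ,
  x*y≢0⇒y≢0 (sign *ᴳ N i j) (det k (strike N i j)) term≢0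
  where sign = altSign (toℕ i + toℕ j)

laplaceTerm≡0 : ∀ {k} (N : Matrix (suc k)) i j → N i j ≡ 0ᴳ → laplaceTerm N i j ≡ 0ᴳ
laplaceTerm≡0 {k} N i j Nij≡0 = begin
  (sign *ᴳ N i j) *ᴳ det k (strike N i j)  ≡⟨ cong (λ t → (sign *ᴳ t) *ᴳ det k (strike N i j)) Nij≡0 ⟩
  (sign *ᴳ 0ᴳ) *ᴳ det k (strike N i j)     ≡⟨ cong (_*ᴳ det k (strike N i j)) (GIRing.zeroʳ sign) ⟩
  0ᴳ *ᴳ det k (strike N i j)               ≡⟨ GIRing.zeroˡ (det k (strike N i j)) ⟩
  0ᴳ                                       ∎
  where
  open ≡-Reasoning
  sign = altSign (toℕ i + toℕ j)

∘punchIn-injective : ∀ {k n} {ρ : Fin (suc k) → Fin n} → Injective _≡_ _≡_ ρ → ∀ p →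
  Injective _≡_ _≡_ (ρ ∘ punchIn p)
∘punchIn-injective ρ-inj p e = FP.punchIn-injective p _ _ (ρ-inj e)

module _ {n} {M : Matrix n} where

  nonzeroMinor-mono : ∀ {k} {P P′ Q Q′ : Pred (Fin n) 0ℓ} → P ⊆ P′ → Q ⊆ Q′ →
    NonzeroMinorIn M k P Q → NonzeroMinorIn M k P′ Q′
  nonzeroMinor-mono P⊆P′ Q⊆Q′ (nonzeroMinor ρ γ ρ-inj γ-inj ρ∈P γ∈Q minor≢0) =
    nonzeroMinor ρ γ ρ-inj γ-inj (λ i → P⊆P′ (ρ∈P i)) (λ j → Q⊆Q′ (γ∈Q j)) minor≢0

  nonzeroMinor-transpose : ∀ {k P Q} → NonzeroMinorIn M k P Q → NonzeroMinorIn (transpose M) k Q P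
  nonzeroMinor-transpose {k} (nonzeroMinor ρ γ ρ-inj γ-inj ρ∈P γ∈Q minor≢0) =
    nonzeroMinor γ ρ γ-inj ρ-inj γ∈Q ρ∈P (λ e → minor≢0 (trans (sym (det-transpose k (submatrix M ρ γ))) e))

  nonzeroMinor-0 : NonzeroMinor M 0
  nonzeroMinor-0 = nonzeroMinor (λ ()) (λ ()) (λ { {()} }) (λ { {()} }) (λ ()) (λ ()) (λ ())

  nonzeroMinor-shrink : ∀ {k P Q} → NonzeroMinorIn M (suc k) P Q → NonzeroMinorIn M k P Q
  nonzeroMinor-shrink {k} (nonzeroMinor ρ γ ρ-inj γ-inj ρ∈P γ∈Q minor≢0)
    with sumF≢0⇒term≢0 (laplaceTerm (submatrix M ρ γ) zero) minor≢0
  ... | j , term≢0 =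
    nonzeroMinor (ρ ∘ suc) (γ ∘ punchIn j) (∘punchIn-injective ρ-inj zero) (∘punchIn-injective γ-inj j)
      (λ r → ρ∈P (suc r)) (λ s → γ∈Q (punchIn j s)) (proj₂ (laplaceTerm≢0 (submatrix M ρ γ) zero j term≢0))

  nonzeroMinor-expandRow : ∀ {k P Q} v → NonzeroMinorIn M (suc k) P Q →
    NonzeroMinorIn M (suc k) (P ∩ (_≢ v)) Q ⊎
    Σ[ w ∈ Fin n ] M v w ≢ 0ᴳ × NonzeroMinorIn M k (P ∩ (_≢ v)) (Q ∩ (_≢ w))
  nonzeroMinor-expandRow {k} v (nonzeroMinor ρ γ ρ-inj γ-inj ρ∈P γ∈Q minor≢0)
    with FP.any? (λ p → ρ p FP.≟ v)
  ... | no v∉ρ = inj₁ (nonzeroMinor ρ γ ρ-inj γ-inj (λ i → ρ∈P i , λ e → v∉ρ (i , e)) γ∈Q minor≢0)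
  ... | yes (p , refl)
    with sumF≢0⇒term≢0 (laplaceTerm (submatrix M ρ γ) p)
                       (λ e → minor≢0 (trans (det-expandRow k (submatrix M ρ γ) p) e))
  ...   | j , term≢0 with laplaceTerm≢0 (submatrix M ρ γ) p j term≢0
  ...     | entry≢0 , struck≢0 = inj₂ (γ j , entry≢0 ,
    nonzeroMinor (ρ ∘ punchIn p) (γ ∘ punchIn j) (∘punchIn-injective ρ-inj p) (∘punchIn-injective γ-inj j)
      (λ r → ρ∈P (punchIn p r) , λ e → FP.punchInᵢ≢i p r (ρ-inj e))
      (λ s → γ∈Q (punchIn j s) , λ e → FP.punchInᵢ≢i j s (γ-inj e)) struck≢0)

  nonzeroMinor-dropRow : ∀ {k P Q} v → NonzeroMinorIn M (suc k) P Q → NonzeroMinorIn M k (P ∩ (_≢ v)) Q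
  nonzeroMinor-dropRow v X with nonzeroMinor-expandRow v X
  ... | inj₁ X′           = nonzeroMinor-shrink X′
  ... | inj₂ (_ , _ , X′) = nonzeroMinor-mono id proj₁ X′

  nonzeroMinor-zeroRow : ∀ {k P Q} v → (∀ w → M v w ≡ 0ᴳ) →
    NonzeroMinorIn M k P Q → NonzeroMinorIn M k (P ∩ (_≢ v)) Q
  nonzeroMinor-zeroRow {zero} v _ (nonzeroMinor ρ γ ρ-inj γ-inj _ γ∈Q minor≢0) =
    nonzeroMinor ρ γ ρ-inj γ-inj (λ ()) γ∈Q minor≢0
  nonzeroMinor-zeroRow {suc k} v row≡0 X with nonzeroMinor-expandRow v X
  ... | inj₁ X′               = X′
  ... | inj₂ (w , Mvw≢0 , _) = ⊥-elim (Mvw≢0 (row≡0 w))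

  nonzeroMinor-pendantRow : ∀ {k P Q} x y → (∀ w → w ≢ y → M x w ≡ 0ᴳ) → NonzeroMinorIn M (suc k) P Q →
    NonzeroMinorIn M k (P ∩ (_≢ x)) (Q ∩ (_≢ y)) ⊎ NonzeroMinorIn M (suc k) (P ∩ (_≢ x)) Q
  nonzeroMinor-pendantRow x y row-x X with nonzeroMinor-expandRow x X
  ... | inj₁ X′ = inj₂ X′
  ... | inj₂ (w , Mxw≢0 , X′) with w FP.≟ y
  ...   | yes refl = inj₁ X′
  ...   | no  w≢y  = ⊥-elim (Mxw≢0 (row-x w w≢y))

module _ {n} {M : Matrix n} where

  nonzeroMinor-dropCol : ∀ {k P Q} v → NonzeroMinorIn M (suc k) P Q → NonzeroMinorIn M k P (Q ∩ (_≢ v))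
  nonzeroMinor-dropCol v X = nonzeroMinor-transpose (nonzeroMinor-dropRow v (nonzeroMinor-transpose X))

  nonzeroMinor-zeroCol : ∀ {k P Q} v → (∀ w → M w v ≡ 0ᴳ) →
    NonzeroMinorIn M k P Q → NonzeroMinorIn M k P (Q ∩ (_≢ v))
  nonzeroMinor-zeroCol v col≡0 X =
    nonzeroMinor-transpose (nonzeroMinor-zeroRow v col≡0 (nonzeroMinor-transpose X))

  nonzeroMinor-pendantCol : ∀ {k P Q} x y → (∀ w → w ≢ y → M w x ≡ 0ᴳ) → NonzeroMinorIn M (suc k) P Q →
    NonzeroMinorIn M k (P ∩ (_≢ y)) (Q ∩ (_≢ x)) ⊎ NonzeroMinorIn M (suc k) P (Q ∩ (_≢ x))
  nonzeroMinor-pendantCol x y col-x X =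
    Sum.map nonzeroMinor-transpose nonzeroMinor-transpose
            (nonzeroMinor-pendantRow x y col-x (nonzeroMinor-transpose X))

module _ {n} {M : Matrix n} where

  hasRank⇒nonzeroMinor : ∀ {r} → HasRank M r → NonzeroMinor M r
  hasRank⇒nonzeroMinor ((ρ , γ , ρ-inj , γ-inj , minor≢0) , _) = nonzeroMinor ρ γ ρ-inj γ-inj _ _ minor≢0

  hasRank⇒maximal : ∀ {r k} → HasRank M r → NonzeroMinor M k → k ≤ r
  hasRank⇒maximal {r} {k} (_ , vanish) (nonzeroMinor ρ γ ρ-inj γ-inj _ _ minor≢0) with k ℕ.≤? r
  ... | yes k≤r = k≤r
  ... | no  k≰r = ⊥-elim (minor≢0 (vanish k (ℕP.≰⇒> k≰r) ρ γ ρ-inj γ-inj))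

  hasRank-intro : ∀ {r} → NonzeroMinor M r → (∀ {k} → NonzeroMinor M k → k ≤ r) → HasRank M r
  hasRank-intro {r} (nonzeroMinor ρ γ ρ-inj γ-inj _ _ minor≢0) maximal =
    (ρ , γ , ρ-inj , γ-inj , minor≢0) ,
    λ k r<k ρ′ γ′ ρ′-inj γ′-inj → decidable-stable (minor M k ρ′ γ′ ≟ᴳ 0ᴳ) λ minor′≢0 →
      ℕP.<⇒≱ r<k (maximal (nonzeroMinor ρ′ γ′ ρ′-inj γ′-inj _ _ minor′≢0))

module _ {m n} {M : Matrix n} {e : Fin m → Fin n} {P : Pred (Fin n) 0ℓ} where

  nonzeroMinor-restrict⁺ : ∀ {k} → Injective _≡_ _≡_ e → (∀ a → P (e a)) →
    NonzeroMinor (restrict M e) k → NonzeroMinorIn M k P P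
  nonzeroMinor-restrict⁺ e-inj e∈P (nonzeroMinor ρ γ ρ-inj γ-inj _ _ minor≢0) =
    nonzeroMinor (e ∘ ρ) (e ∘ γ) (λ eq → ρ-inj (e-inj eq)) (λ eq → γ-inj (e-inj eq))
      (λ i → e∈P (ρ i)) (λ j → e∈P (γ j)) minor≢0

  nonzeroMinor-restrict⁻ : ∀ {k} → (∀ u → P u → Σ[ a ∈ Fin m ] e a ≡ u) →
    NonzeroMinorIn M k P P → NonzeroMinor (restrict M e) k
  nonzeroMinor-restrict⁻ {k} e-onto (nonzeroMinor ρ γ ρ-inj γ-inj ρ∈P γ∈P minor≢0) =
    nonzeroMinor (lift ρ ρ∈P) (lift γ γ∈P) (lift-injective ρ ρ∈P ρ-inj) (lift-injective γ γ∈P γ-inj) _ _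
      (λ eq → minor≢0 (trans (sym (det-cong k λ i j → cong₂ M (lift-section ρ ρ∈P i) (lift-section γ γ∈P j))) eq))
    where
    lift : (σ : Fin k → Fin n) → (∀ i → P (σ i)) → Fin k → Fin m
    lift σ σ∈P i = proj₁ (e-onto (σ i) (σ∈P i))
    lift-section : ∀ σ σ∈P i → e (lift σ σ∈P i) ≡ σ i
    lift-section σ σ∈P i = proj₂ (e-onto (σ i) (σ∈P i))
    lift-injective : ∀ σ σ∈P → Injective _≡_ _≡_ σ → Injective _≡_ _≡_ (lift σ σ∈P)
    lift-injective σ σ∈P σ-inj {i} {j} eq =
      σ-inj (trans (sym (lift-section σ σ∈P i)) (trans (cong e eq) (lift-section σ σ∈P j)))

module _ {n} (M : Matrix (suc n)) (v : Fin (suc n)) where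

  private
    punchIn-onto : ∀ u → u ≢ v → Σ[ a ∈ Fin n ] punchIn v a ≡ u
    punchIn-onto u u≢v = punchOut (u≢v ∘ sym) , FP.punchIn-punchOut (u≢v ∘ sym)

  nonzeroMinor-deleteIndex : ∀ {k} → NonzeroMinor M k → NonzeroMinor (restrict M (punchIn v)) (k ∸ 2)
  nonzeroMinor-deleteIndex {zero}        X = nonzeroMinor-0
  nonzeroMinor-deleteIndex {suc zero}    X = nonzeroMinor-0
  nonzeroMinor-deleteIndex {suc (suc k)} X = nonzeroMinor-restrict⁻ punchIn-onto
    (nonzeroMinor-mono proj₂ proj₂ (nonzeroMinor-dropCol v (nonzeroMinor-dropRow v X)))

  nonzeroMinor-deleteZeroIndex : ∀ {k} → (∀ w → M v w ≡ 0ᴳ) → (∀ w → M w v ≡ 0ᴳ) →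
    NonzeroMinor M k → NonzeroMinor (restrict M (punchIn v)) k
  nonzeroMinor-deleteZeroIndex row≡0 col≡0 X = nonzeroMinor-restrict⁻ punchIn-onto
    (nonzeroMinor-mono proj₂ proj₂ (nonzeroMinor-zeroCol v col≡0 (nonzeroMinor-zeroRow v row≡0 X)))

  nonzeroMinor-undeleteIndex : ∀ {k} → NonzeroMinor (restrict M (punchIn v)) k → NonzeroMinor M k
  nonzeroMinor-undeleteIndex X =
    nonzeroMinor-mono (λ _ → tt) (λ _ → tt) (nonzeroMinor-restrict⁺ {P = _≢ v} (FP.punchIn-injective v _ _) (FP.punchInᵢ≢i v) X)

∷-injective : ∀ {k n} {a : Fin n} {f : Fin k → Fin n} → (∀ i → f i ≢ a) → Injective _≡_ _≡_ f →
  Injective _≡_ _≡_ (a Vec.∷ f)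
∷-injective f≢a f-inj {zero}  {zero}  _ = refl
∷-injective f≢a f-inj {zero}  {suc j} e = ⊥-elim (f≢a j (sym e))
∷-injective f≢a f-inj {suc i} {zero}  e = ⊥-elim (f≢a i e)
∷-injective f≢a f-inj {suc i} {suc j} e = cong suc (f-inj e)

module PendantIndex {n} (M : Matrix (suc (suc n))) (x y : Fin (suc (suc n))) (x≢y : x ≢ y)
  (row-x : ∀ w → w ≢ y → M x w ≡ 0ᴳ) (col-x : ∀ w → w ≢ y → M w x ≡ 0ᴳ)
  (Mxy-unit : IsUnit (M x y)) (Myx-unit : IsUnit (M y x)) where

  y′ : Fin (suc n)
  y′ = punchOut x≢y

  outside : Fin n → Fin (suc (suc n))
  outside = punchIn x ∘ punchIn y′

  M′ : Matrix n
  M′ = restrict M outside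

  Outside : Pred (Fin (suc (suc n))) 0ℓ
  Outside = (_≢ x) ∩ (_≢ y)

  private
    punchIn-y′ : punchIn x y′ ≡ y
    punchIn-y′ = FP.punchIn-punchOut x≢y

    outside-injective : Injective _≡_ _≡_ outside
    outside-injective eq = FP.punchIn-injective y′ _ _ (FP.punchIn-injective x _ _ eq)

    outside∈Outside : ∀ a → Outside (outside a)
    outside∈Outside a = FP.punchInᵢ≢i x _ ,
      λ eq → FP.punchInᵢ≢i y′ a (FP.punchIn-injective x _ _ (trans eq (sym punchIn-y′)))

    outside-onto : ∀ u → Outside u → Σ[ a ∈ Fin n ] outside a ≡ u
    outside-onto u (u≢x , u≢y) =
      punchOut y′≢u′ , trans (cong (punchIn x) (FP.punchIn-punchOut y′≢u′)) (FP.punchIn-punchOut x≢u)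
      where
      x≢u = u≢x ∘ sym
      y′≢u′ : y′ ≢ punchOut x≢u
      y′≢u′ eq = u≢y (trans (sym (FP.punchIn-punchOut x≢u)) (trans (cong (punchIn x) (sym eq)) punchIn-y′))

    xy⊆Outside : (U ∩ (_≢ x)) ∩ (_≢ y) ⊆ Outside
    xy⊆Outside ((_ , u≢x) , u≢y) = u≢x , u≢y

    yx⊆Outside : (U ∩ (_≢ y)) ∩ (_≢ x) ⊆ Outside
    yx⊆Outside ((_ , u≢y) , u≢x) = u≢x , u≢y

  -- Rows x, y and columns y, x in front: the determinant is M x y · M y x times the old minor.
  nonzeroMinor-extend : ∀ {k} → NonzeroMinorIn M k Outside Outside → NonzeroMinor M (2 + k)
  nonzeroMinor-extend {k} (nonzeroMinor ρ γ ρ-inj γ-inj ρ∈Outside γ∈Outside minor≢0) =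
    nonzeroMinor rows cols
      (∷-injective (λ { zero → x≢y ∘ sym ; (suc i) → proj₁ (ρ∈Outside i) })
                   (∷-injective (λ i → proj₂ (ρ∈Outside i)) ρ-inj))
      (∷-injective (λ { zero → x≢y ; (suc j) → proj₂ (γ∈Outside j) })
                   (∷-injective (λ j → proj₁ (γ∈Outside j)) γ-inj))
      _ _ extended≢0
    where
    rows cols : Fin (2 + k) → Fin (suc (suc n))
    rows = x Vec.∷ y Vec.∷ ρ
    cols = y Vec.∷ x Vec.∷ γ
    N₁ : Matrix (suc k)
    N₁ = submatrix M (y Vec.∷ ρ) (x Vec.∷ γ)
    expandRow-x : minor M (2 + k) rows cols ≡ (1ᴳ *ᴳ M x y) *ᴳ det (suc k) N₁
    expandRow-x = sumF-single (laplaceTerm (submatrix M rows cols) zero) zero λ j →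
      laplaceTerm≡0 (submatrix M rows cols) zero (suc j) (row-x (cols (suc j)) (cols≢y j))
      where
      cols≢y : ∀ j → cols (suc j) ≢ y
      cols≢y zero    = x≢y
      cols≢y (suc j) = proj₂ (γ∈Outside j)
    expandCol-x : det (suc k) N₁ ≡ (1ᴳ *ᴳ M y x) *ᴳ minor M k ρ γ
    expandCol-x = trans (det-expandColumn k N₁ zero) (sumF-single (λ i → laplaceTerm N₁ i zero) zero λ i →
      laplaceTerm≡0 N₁ (suc i) zero (col-x (ρ i) (proj₂ (ρ∈Outside i))))
    extended≢0 : minor M (2 + k) rows cols ≢ 0ᴳ
    extended≢0 eq = minor≢0 (unit*x≡0⇒x≡0 (subst IsUnit (sym (*ᴳ-identityˡ (M y x))) Myx-unit) (minor M k ρ γ)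
      (trans (sym expandCol-x) (unit*x≡0⇒x≡0 (subst IsUnit (sym (*ᴳ-identityˡ (M x y))) Mxy-unit) (det (suc k) N₁)
        (trans (sym expandRow-x) eq))))

  nonzeroMinor-strip : ∀ {k} → NonzeroMinor M (2 + k) → NonzeroMinorIn M k Outside Outside
  nonzeroMinor-strip X = [ usesRow-x , avoidsRow-x ]′ (nonzeroMinor-pendantRow x y row-x X)
    where
    usesRow-x : ∀ {k} → NonzeroMinorIn M (suc k) (U ∩ (_≢ x)) (U ∩ (_≢ y)) → NonzeroMinorIn M k Outside Outside
    usesRow-x X₁ = [ nonzeroMinor-mono xy⊆Outside yx⊆Outside
                   , nonzeroMinor-mono xy⊆Outside yx⊆Outside ∘ nonzeroMinor-dropRow y
                   ]′ (nonzeroMinor-pendantCol x y col-x X₁)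
    avoidsRow-x : ∀ {k} → NonzeroMinorIn M (2 + k) (U ∩ (_≢ x)) U → NonzeroMinorIn M k Outside Outside
    avoidsRow-x X₁ = [ nonzeroMinor-mono xy⊆Outside xy⊆Outside ∘ nonzeroMinor-dropCol y
                     , nonzeroMinor-mono xy⊆Outside xy⊆Outside ∘ nonzeroMinor-dropCol y ∘ nonzeroMinor-dropRow y
                     ]′ (nonzeroMinor-pendantCol x y col-x X₁)

  nonzeroMinor-lift : ∀ {k} → NonzeroMinor M′ k → NonzeroMinor M (2 + k)
  nonzeroMinor-lift X = nonzeroMinor-extend (nonzeroMinor-restrict⁺ outside-injective outside∈Outside X)

  nonzeroMinor-drop : ∀ {k} → NonzeroMinor M k → NonzeroMinor M′ (k ∸ 2)
  nonzeroMinor-drop {zero}        _ = nonzeroMinor-0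
  nonzeroMinor-drop {suc zero}    _ = nonzeroMinor-0
  nonzeroMinor-drop {suc (suc k)} X = nonzeroMinor-restrict⁻ outside-onto (nonzeroMinor-strip X)

  hasRank⁺ : ∀ {r} → HasRank M′ r → HasRank M (2 + r)
  hasRank⁺ rank′ = hasRank-intro (nonzeroMinor-lift (hasRank⇒nonzeroMinor rank′)) λ {k} X →
    ℕP.≤-trans (ℕP.m≤n+m∸n k 2) (ℕP.+-monoʳ-≤ 2 (hasRank⇒maximal rank′ (nonzeroMinor-drop X)))

  hasRank⁻ : ∀ {R} → HasRank M R → Σ[ r ∈ ℕ ] R ≡ 2 + r × HasRank M′ r
  hasRank⁻ {R} rank = R ∸ 2 , sym (ℕP.m+[n∸m]≡n 2≤R) ,
    hasRank-intro (nonzeroMinor-drop (hasRank⇒nonzeroMinor rank))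
                  (λ X → ℕP.∸-monoˡ-≤ 2 (hasRank⇒maximal rank (nonzeroMinor-lift X)))
    where
    2≤R : 2 ≤ R
    2≤R = hasRank⇒maximal rank (nonzeroMinor-lift nonzeroMinor-0)

-- Connected components

HasComponents : ∀ {n} → Rel (Fin n) 0ℓ → ℕ → Set
HasComponents {n} R c =
  Σ[ f ∈ (Fin n → Fin c) ] Surjective _≡_ _≡_ f × (∀ u v → (f u ≡ f v) ⇔ Star R u v)

module _ {n} {R : Rel (Fin n) 0ℓ} where

  star-invariant : ∀ {c} (f : Fin n → Fin c) → (∀ {u w} → R u w → f u ≡ f w) → ∀ {u v} → Star R u v → f u ≡ f v
  star-invariant f invariant = Star.fold (λ u v → f u ≡ f v) (λ r eq → trans (invariant r) eq) refl

  hasComponents-resp : ∀ {R′ c} → R ⇒ R′ → R′ ⇒ R → HasComponents R c → HasComponents R′ c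
  hasComponents-resp R⇒R′ R′⇒R (f , f-onto , same⇔linked) = f , f-onto , λ u v →
    mk⇔ (Star.map R⇒R′ ∘ Equivalence.to (same⇔linked u v)) (Equivalence.from (same⇔linked u v) ∘ Star.map R′⇒R)

  hasComponents-≤ : ∀ {c c′} → HasComponents R c → HasComponents R c′ → c ≤ c′
  hasComponents-≤ {c} {c′} (f , f-onto , same⇔linked) (f′ , _ , same⇔linked′) = FP.injective⇒≤ g-injective
    where
    rep : Fin c → Fin n
    rep i = proj₁ (f-onto i)
    f-rep : ∀ i → f (rep i) ≡ i
    f-rep i = proj₂ (f-onto i) refl
    g-injective : Injective _≡_ _≡_ (f′ ∘ rep)
    g-injective {i} {j} eq = trans (sym (f-rep i)) (trans (Equivalence.from (same⇔linked (rep i) (rep j))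
      (Equivalence.to (same⇔linked′ (rep i) (rep j)) eq)) (f-rep j))

  hasComponents-unique : ∀ {c c′} → HasComponents R c → HasComponents R c′ → c ≡ c′
  hasComponents-unique C C′ = ℕP.≤-antisym (hasComponents-≤ C C′) (hasComponents-≤ C′ C)

  linked? : ∀ {c} → HasComponents R c → ∀ u v → Dec (Star R u v)
  linked? (f , _ , same⇔linked) u v = map′ (Equivalence.to (same⇔linked u v)) (Equivalence.from (same⇔linked u v)) (f u FP.≟ f v)

WithEdge : ∀ {n} → Rel (Fin n) 0ℓ → Fin n → Fin n → Rel (Fin n) 0ℓ
WithEdge R a b u w = R u w ⊎ (u ≡ a × w ≡ b) ⊎ (u ≡ b × w ≡ a)

module _ {n} {R : Rel (Fin n) 0ℓ} {a b : Fin n} where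

  hasComponents-withEdge-linked : ∀ {c} (C : HasComponents R c) → proj₁ C a ≡ proj₁ C b →
    HasComponents (WithEdge R a b) c
  hasComponents-withEdge-linked (f , f-onto , same⇔linked) fa≡fb = f , f-onto , λ u v →
    mk⇔ (Star.map inj₁ ∘ Equivalence.to (same⇔linked u v)) (star-invariant f invariant)
    where
    invariant : ∀ {u w} → WithEdge R a b u w → f u ≡ f w
    invariant {u} {w} (inj₁ r)                  = Equivalence.from (same⇔linked u w) (r ◅ ε)
    invariant         (inj₂ (inj₁ (refl , refl))) = fa≡fb
    invariant         (inj₂ (inj₂ (refl , refl))) = sym fa≡fb

  -- The component of b is renamed to that of a, and the now unused label f b is punched out.
  hasComponents-withEdge-merge : ∀ {c} (C : HasComponents R (suc c)) → proj₁ C a ≢ proj₁ C b →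
    HasComponents (WithEdge R a b) c
  hasComponents-withEdge-merge {c} (f , f-onto , same⇔linked) fa≢fb =
    f′ , f′-onto , λ u v → mk⇔ (linked u v) (star-invariant f′ invariant)
    where
    merged : Fin (suc c) → Σ[ z ∈ Fin (suc c) ] f b ≢ z
    merged z with z FP.≟ f b
    ... | yes _   = f a , fa≢fb ∘ sym
    ... | no  z≢b = z , z≢b ∘ sym
    merged-b : ∀ {z} → z ≡ f b → proj₁ (merged z) ≡ f a
    merged-b {z} z≡b with z FP.≟ f b
    ... | yes _   = refl
    ... | no  z≢b = ⊥-elim (z≢b z≡b)
    merged-other : ∀ {z} → z ≢ f b → proj₁ (merged z) ≡ z
    merged-other {z} z≢b with z FP.≟ f b
    ... | yes z≡b = ⊥-elim (z≢b z≡b)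
    ... | no  _   = refl
    label : Fin (suc c) → Fin c
    label z = punchOut (proj₂ (merged z))
    f′ : Fin n → Fin c
    f′ = label ∘ f
    label-injective : ∀ z z′ → label z ≡ label z′ → proj₁ (merged z) ≡ proj₁ (merged z′)
    label-injective z z′ = FP.punchOut-injective (proj₂ (merged z)) (proj₂ (merged z′))
    fa-merged : proj₁ (merged (f a)) ≡ proj₁ (merged (f b))
    fa-merged = trans (merged-other fa≢fb) (sym (merged-b refl))
    invariant : ∀ {u w} → WithEdge R a b u w → f′ u ≡ f′ w
    invariant {u} {w} (inj₁ r)                  = cong label (Equivalence.from (same⇔linked u w) (r ◅ ε))
    invariant         (inj₂ (inj₁ (refl , refl))) = FP.punchOut-cong (f b) fa-merged
    invariant         (inj₂ (inj₂ (refl , refl))) = FP.punchOut-cong (f b) (sym fa-merged)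
    old : ∀ u v → f u ≡ f v → Star (WithEdge R a b) u v
    old u v = Star.map inj₁ ∘ Equivalence.to (same⇔linked u v)
    linked : ∀ u v → f′ u ≡ f′ v → Star (WithEdge R a b) u v
    linked u v eq with label-injective (f u) (f v) eq | f u FP.≟ f b | f v FP.≟ f b
    ... | _  | yes u∼b | yes v∼b = old u v (trans u∼b (sym v∼b))
    ... | eq′ | yes u∼b | no v≁b =
      old u b u∼b ◅◅ inj₂ (inj₂ (refl , refl)) ◅ old a v (trans (sym (merged-b u∼b)) (trans eq′ (merged-other v≁b)))
    ... | eq′ | no u≁b | yes v∼b =
      old u a (trans (sym (merged-other u≁b)) (trans eq′ (merged-b v∼b))) ◅◅ inj₂ (inj₁ (refl , refl)) ◅ old b v (sym v∼b)
    ... | eq′ | no u≁b | no v≁b = old u v (trans (sym (merged-other u≁b)) (trans eq′ (merged-other v≁b)))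
    f′-onto : Surjective _≡_ _≡_ f′
    f′-onto t = u , λ { refl → trans (FP.punchOut-cong (f b) (trans (merged-other fu≢fb) fu≡)) (FP.punchOut-punchIn (f b)) }
      where
      u = proj₁ (f-onto (punchIn (f b) t))
      fu≡ : f u ≡ punchIn (f b) t
      fu≡ = proj₂ (f-onto (punchIn (f b) t)) refl
      fu≢fb : f u ≢ f b
      fu≢fb eq = FP.punchInᵢ≢i (f b) t (trans (sym fu≡) eq)

reverseKind≡none : ∀ k → reverseKind k ≡ none → k ≡ none
reverseKind≡none none _ = refl

adj-sym : ∀ {n} (G : MixedGraph n) {u w} → Adj G u w → Adj G w u
adj-sym G {u} {w} uw wu≡none = uw (reverseKind≡none _ (trans (sym (symm G u w)) wu≡none))

adj-irrefl : ∀ {n} (G : MixedGraph n) {u} → ¬ Adj G u u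
adj-irrefl G {u} uu = uu (loopless G u)

isEdge≡true⇒≢none : ∀ k → isEdge k ≡ true → k ≢ none
isEdge≡true⇒≢none none ()

≢none⇒isEdge≡true : ∀ k → k ≢ none → isEdge k ≡ true
≢none⇒isEdge≡true none       k≢none = ⊥-elim (k≢none refl)
≢none⇒isEdge≡true undirected _      = refl
≢none⇒isEdge≡true forward    _      = refl
≢none⇒isEdge≡true backward   _      = refl

_≟ᴱ_ : DecidableEquality EdgeKind
none       ≟ᴱ none       = yes refl
undirected ≟ᴱ undirected = yes refl
forward    ≟ᴱ forward    = yes refl
backward   ≟ᴱ backward   = yes refl
none       ≟ᴱ undirected = no λ ()
none       ≟ᴱ forward    = no λ ()
none       ≟ᴱ backward   = no λ ()
undirected ≟ᴱ none       = no λ ()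
undirected ≟ᴱ forward    = no λ ()
undirected ≟ᴱ backward   = no λ ()
forward    ≟ᴱ none       = no λ ()
forward    ≟ᴱ undirected = no λ ()
forward    ≟ᴱ backward   = no λ ()
backward   ≟ᴱ none       = no λ ()
backward   ≟ᴱ undirected = no λ ()
backward   ≟ᴱ forward    = no λ ()

adj? : ∀ {n} (G : MixedGraph n) u w → Dec (Adj G u w)
adj? G u w = ¬? (edge G u w ≟ᴱ none)

indicator : Bool → ℕ
indicator b = if b then 1 else 0

degree : ∀ {n} → MixedGraph n → Fin n → ℕ
degree G v = sumℕ (λ w → indicator (isEdge (edge G v w)))

consIf : ∀ {A : Set} → Bool → A → List A → List A
consIf true  a xs = a ∷ xs
consIf false a xs = xs

trueIndices : ∀ {k} → (Fin k → Bool) → List (Fin k)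
trueIndices {zero}  b = []
trueIndices {suc k} b = consIf (b zero) zero (List.map suc (trueIndices (b ∘ suc)))

trueIndices-length : ∀ {k} (b : Fin k → Bool) → length (trueIndices b) ≡ sumℕ (indicator ∘ b)
trueIndices-length {zero}  b = refl
trueIndices-length {suc k} b with b zero
... | true  = cong suc (trans (LP.length-map suc (trueIndices (b ∘ suc))) (trueIndices-length (b ∘ suc)))
... | false = trans (LP.length-map suc (trueIndices (b ∘ suc))) (trueIndices-length (b ∘ suc))

trueIndices-sound : ∀ {k} (b : Fin k → Bool) {w} → w ∈ trueIndices b → b w ≡ true
trueIndices-sound {suc k} b w∈ with b zero in b0
trueIndices-sound {suc k} b (here refl) | true = b0
trueIndices-sound {suc k} b (there w∈) | true with ∈-map⁻ suc w∈
... | _ , w∈′ , refl = trueIndices-sound (b ∘ suc) w∈′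
trueIndices-sound {suc k} b w∈ | false with ∈-map⁻ suc w∈
... | _ , w∈′ , refl = trueIndices-sound (b ∘ suc) w∈′

trueIndices-complete : ∀ {k} (b : Fin k → Bool) {w} → b w ≡ true → w ∈ trueIndices b
trueIndices-complete {suc k} b {zero} bw with b zero
trueIndices-complete {suc k} b {zero} refl | .true = here refl
trueIndices-complete {suc k} b {suc w} bw with b zero
... | true  = there (∈-map⁺ suc (trueIndices-complete (b ∘ suc) bw))
... | false = ∈-map⁺ suc (trueIndices-complete (b ∘ suc) bw)

trueIndices-unique : ∀ {k} (b : Fin k → Bool) → Unique (trueIndices b)
trueIndices-unique {zero}  b = []
trueIndices-unique {suc k} b with b zero
... | true  = AllProps.map⁺ (All.universal (λ _ ()) _) ∷ sucs-unique
  where sucs-unique = UniqueProps.map⁺ FP.suc-injective (trueIndices-unique (b ∘ suc))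
... | false = UniqueProps.map⁺ FP.suc-injective (trueIndices-unique (b ∘ suc))

-- Components after deleting a vertex

AdjAvoiding : ∀ {n} → MixedGraph n → Fin n → Rel (Fin n) 0ℓ
AdjAvoiding G v u w = Adj G u w × u ≢ v × w ≢ v

-- "v lies on a cycle" in path form; equivalent to OnCycle by onCycle⇒cycleThrough and its converse.
CycleThrough : ∀ {n} → MixedGraph n → Fin n → Set
CycleThrough {n} G v = Σ[ a ∈ Fin n ] Σ[ b ∈ Fin n ] Adj G v a × Adj G v b × a ≢ b × Star (AdjAvoiding G v) a b

adjAvoiding-sym : ∀ {n} (G : MixedGraph n) v {u w} → AdjAvoiding G v u w → AdjAvoiding G v w u
adjAvoiding-sym G v (uw , u≢v , w≢v) = adj-sym G uw , w≢v , u≢v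

module VertexDeletion {n} (G : MixedGraph (suc n)) (v : Fin (suc n)) where

  G′ : MixedGraph n
  G′ = deleteVertex G v

  Away : Rel (Fin (suc n)) 0ℓ
  Away = AdjAvoiding G v

  private
    unpunch : ∀ u → u ≢ v → Fin n
    unpunch u u≢v = punchOut (u≢v ∘ sym)

    punchIn-unpunch : ∀ u u≢v → punchIn v (unpunch u u≢v) ≡ u
    punchIn-unpunch u u≢v = FP.punchIn-punchOut (u≢v ∘ sym)

    unpunch-irrelevant : ∀ u (p q : u ≢ v) → unpunch u p ≡ unpunch u q
    unpunch-irrelevant u p q = FP.punchOut-cong v refl

  star-punchIn : ∀ {a b} → Star (Adj G′) a b → Star Away (punchIn v a) (punchIn v b)
  star-punchIn = Star.gmap (punchIn v) (λ {a} {b} ab → ab , FP.punchInᵢ≢i v a , FP.punchInᵢ≢i v b)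

  star-unpunch : ∀ {u w} → Star Away u w → (u≢v : u ≢ v) (w≢v : w ≢ v) →
    Star (Adj G′) (unpunch u u≢v) (unpunch w w≢v)
  star-unpunch {u} ε u≢v w≢v = subst (Star (Adj G′) (unpunch u u≢v)) (unpunch-irrelevant u u≢v w≢v) ε
  star-unpunch {u} (_◅_ {j = t} (ut , _ , t≢v) path) u≢v w≢v = ut′ ◅ star-unpunch path t≢v w≢v
    where
    ut′ : Adj G′ (unpunch u u≢v) (unpunch t t≢v)
    ut′ e = ut (subst₂ (λ s s′ → edge G s s′ ≡ none) (punchIn-unpunch u u≢v) (punchIn-unpunch t t≢v) e)

  star-from-v : ∀ {w} → Star Away v w → w ≡ v
  star-from-v ε                    = refl
  star-from-v ((_ , v≢v , _) ◅ _) = ⊥-elim (v≢v refl)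

  -- Vertex v forms a component of its own, labelled zero.
  hasComponents-away : ∀ {ω′} → HasComponents (Adj G′) ω′ → HasComponents Away (suc ω′)
  hasComponents-away {ω′} (f , f-onto , same⇔linked) = f₀ , f₀-onto , same⇔linked₀
    where
    f₀ : Fin (suc n) → Fin (suc ω′)
    f₀ w with w FP.≟ v
    ... | yes _   = zero
    ... | no  w≢v = suc (f (unpunch w w≢v))
    f₀-v : f₀ v ≡ zero
    f₀-v with v FP.≟ v
    ... | yes _   = refl
    ... | no  v≢v = ⊥-elim (v≢v refl)
    f₀-other : ∀ w (w≢v : w ≢ v) → f₀ w ≡ suc (f (unpunch w w≢v))
    f₀-other w w≢v with w FP.≟ v
    ... | yes w≡v  = ⊥-elim (w≢v w≡v)
    ... | no  w≢v′ = cong (suc ∘ f) (unpunch-irrelevant w w≢v′ w≢v)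
    f₀-onto : Surjective _≡_ _≡_ f₀
    f₀-onto zero    = v , λ { refl → f₀-v }
    f₀-onto (suc t) = punchIn v (proj₁ (f-onto t)) , λ { refl →
      trans (f₀-other _ (FP.punchInᵢ≢i v _)) (cong suc (trans (cong f (FP.punchOut-punchIn v)) (proj₂ (f-onto t) refl))) }
    same⇔linked₀ : ∀ u w → (f₀ u ≡ f₀ w) ⇔ Star Away u w
    same⇔linked₀ u w = cases u w (u FP.≟ v) (w FP.≟ v)
      where
      cases : ∀ u w → Dec (u ≡ v) → Dec (w ≡ v) → (f₀ u ≡ f₀ w) ⇔ Star Away u w
      cases u w (yes refl) (yes refl) = mk⇔ (λ _ → ε) (λ _ → refl)
      cases u w (yes refl) (no w≢v) =
        mk⇔ (λ eq → ⊥-elim (FP.0≢1+n (trans (sym f₀-v) (trans eq (f₀-other w w≢v)))))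
            (λ path → ⊥-elim (w≢v (star-from-v path)))
      cases u w (no u≢v) (yes refl) =
        mk⇔ (λ eq → ⊥-elim (FP.0≢1+n (trans (sym f₀-v) (trans (sym eq) (f₀-other u u≢v)))))
            (λ path → ⊥-elim (u≢v (star-from-v (Star.reverse (adjAvoiding-sym G v) path))))
      cases u w (no u≢v) (no w≢v) = mk⇔
        (λ eq → subst₂ (Star Away) (punchIn-unpunch u u≢v) (punchIn-unpunch w w≢v) (star-punchIn
          (Equivalence.to (same⇔linked _ _) (FP.suc-injective (trans (sym (f₀-other u u≢v)) (trans eq (f₀-other w w≢v)))))))
        (λ path → trans (f₀-other u u≢v)
          (trans (cong suc (Equivalence.from (same⇔linked _ _) (star-unpunch path u≢v w≢v))) (sym (f₀-other w w≢v))))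

  WithEdgesTo : List (Fin (suc n)) → Rel (Fin (suc n)) 0ℓ
  WithEdgesTo S u w = Away u w ⊎ (u ≡ v × w ∈ S) ⊎ (w ≡ v × u ∈ S)

  LinkedIn : List (Fin (suc n)) → Set
  LinkedIn S = Σ[ a ∈ Fin (suc n) ] Σ[ b ∈ Fin (suc n) ] a ∈ S × b ∈ S × a ≢ b × Star Away a b

  lastExit : ∀ {S u w} → Star (WithEdgesTo S) u w → w ≢ v →
    Star Away u w ⊎ Σ[ b ∈ Fin (suc n) ] b ∈ S × Star Away b w
  lastExit ε w≢v = inj₁ ε
  lastExit (_ ◅ path) w≢v with lastExit path w≢v
  ... | inj₂ exit = inj₂ exit
  lastExit (inj₁ away ◅ path)                    w≢v | inj₁ path′ = inj₁ (away ◅ path′)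
  lastExit (inj₂ (inj₁ (_ , b∈S)) ◅ path)        w≢v | inj₁ path′ = inj₂ (_ , b∈S , path′)
  lastExit (inj₂ (inj₂ (refl , _)) ◅ path)       w≢v | inj₁ path′ = ⊥-elim (w≢v (star-from-v path′))

  withEdgesTo-∷⁺ : ∀ {a S} → WithEdgesTo (a ∷ S) ⇒ WithEdge (WithEdgesTo S) v a
  withEdgesTo-∷⁺ (inj₁ away)                        = inj₁ (inj₁ away)
  withEdgesTo-∷⁺ (inj₂ (inj₁ (u≡v , here refl)))    = inj₂ (inj₁ (u≡v , refl))
  withEdgesTo-∷⁺ (inj₂ (inj₁ (u≡v , there w∈S)))   = inj₁ (inj₂ (inj₁ (u≡v , w∈S)))
  withEdgesTo-∷⁺ (inj₂ (inj₂ (w≡v , here refl)))    = inj₂ (inj₂ (refl , w≡v))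
  withEdgesTo-∷⁺ (inj₂ (inj₂ (w≡v , there u∈S)))   = inj₁ (inj₂ (inj₂ (w≡v , u∈S)))

  withEdgesTo-∷⁻ : ∀ {a S} → WithEdge (WithEdgesTo S) v a ⇒ WithEdgesTo (a ∷ S)
  withEdgesTo-∷⁻ (inj₁ (inj₁ away))               = inj₁ away
  withEdgesTo-∷⁻ (inj₁ (inj₂ (inj₁ (u≡v , w∈S)))) = inj₂ (inj₁ (u≡v , there w∈S))
  withEdgesTo-∷⁻ (inj₁ (inj₂ (inj₂ (w≡v , u∈S)))) = inj₂ (inj₂ (w≡v , there u∈S))
  withEdgesTo-∷⁻ (inj₂ (inj₁ (u≡v , refl)))        = inj₂ (inj₁ (u≡v , here refl))
  withEdgesTo-∷⁻ (inj₂ (inj₂ (refl , w≡v)))        = inj₂ (inj₂ (w≡v , here refl))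

  ComponentBounds : ℕ → List (Fin (suc n)) → ℕ → Set
  ComponentBounds ω′ S c = suc ω′ ≤ c + length S × (LinkedIn S → 2 + ω′ ≤ c + length S) ×
                           (¬ LinkedIn S → suc ω′ ≡ c + length S)

  -- Each new edge from v either merges two components or closes a cycle through v.
  addEdgesTo : ∀ {ω′} → HasComponents (Adj G′) ω′ → ∀ S → Unique S → (∀ {a} → a ∈ S → Adj G v a) →
    Σ[ c ∈ ℕ ] HasComponents (WithEdgesTo S) c × ComponentBounds ω′ S c
  addEdgesTo {ω′} C′ [] _ _ = suc ω′ , hasComponents-resp inj₁ fromEmpty (hasComponents-away C′) ,
    ℕP.≤-reflexive (sym (ℕP.+-identityʳ _)) , (λ { (_ , _ , () , _) }) , (λ _ → sym (ℕP.+-identityʳ _))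
    where
    fromEmpty : WithEdgesTo [] ⇒ Away
    fromEmpty (inj₁ away)             = away
    fromEmpty (inj₂ (inj₁ (_ , ())))
    fromEmpty (inj₂ (inj₂ (_ , ())))
  addEdgesTo {ω′} C′ (a ∷ S) (a≢S ∷ S-unique) S⊆N with addEdgesTo C′ S S-unique (S⊆N ∘ there)
  ... | c , C , below , linked , unlinked = extend c C below linked unlinked (proj₁ C v FP.≟ proj₁ C a)
    where
    a∉S : a ∉ S
    a∉S = AllProps.All¬⇒¬Any a≢S
    a≢v : a ≢ v
    a≢v refl = adj-irrefl G (S⊆N (here refl))
    cycle : Star (WithEdgesTo S) v a → LinkedIn (a ∷ S)
    cycle path with lastExit path a≢v
    ... | inj₁ path′          = ⊥-elim (a≢v (star-from-v path′))
    ... | inj₂ (b , b∈S , path′) = b , a , there b∈S , here refl , (λ { refl → a∉S b∈S }) , path′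
    noCycle : ¬ Star (WithEdgesTo S) v a → LinkedIn (a ∷ S) → LinkedIn S
    noCycle unlinked (_ , _ , here refl , here refl   , b≢b , _)    = ⊥-elim (b≢b refl)
    noCycle unlinked (_ , _ , here refl , there b∈S , _ , path) =
      ⊥-elim (unlinked (inj₂ (inj₁ (refl , b∈S)) ◅ Star.map inj₁ (Star.reverse (adjAvoiding-sym G v) path)))
    noCycle unlinked (_ , _ , there b∈S , here refl , _ , path) =
      ⊥-elim (unlinked (inj₂ (inj₁ (refl , b∈S)) ◅ Star.map inj₁ path))
    noCycle unlinked (b , b′ , there b∈S , there b′∈S , b≢b′ , path) = b , b′ , b∈S , b′∈S , b≢b′ , path
    extend : ∀ c (C : HasComponents (WithEdgesTo S) c) → suc ω′ ≤ c + length S →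
      (LinkedIn S → 2 + ω′ ≤ c + length S) → (¬ LinkedIn S → suc ω′ ≡ c + length S) →
      Dec (proj₁ C v ≡ proj₁ C a) → Σ[ c ∈ ℕ ] HasComponents (WithEdgesTo (a ∷ S)) c × ComponentBounds ω′ (a ∷ S) c
    extend c C below _ _ (yes same) =
      c , hasComponents-resp withEdgesTo-∷⁻ withEdgesTo-∷⁺ (hasComponents-withEdge-linked C same) ,
      subst (suc ω′ ≤_) (sym (ℕP.+-suc c _)) (ℕP.m≤n⇒m≤1+n below) ,
      (λ _ → subst (2 + ω′ ≤_) (sym (ℕP.+-suc c _)) (s≤s below)) ,
      (λ unlinked → ⊥-elim (unlinked (cycle (Equivalence.to (proj₂ (proj₂ C) v a) same))))
    extend zero    C _ _ _ (no _) = ⊥-elim (FP.¬Fin0 (proj₁ C v))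
    extend (suc c) C below linked unlinked (no different) =
      c , hasComponents-resp withEdgesTo-∷⁻ withEdgesTo-∷⁺ (hasComponents-withEdge-merge C different) ,
      subst (suc ω′ ≤_) shift below ,
      (λ linked′ → subst (2 + ω′ ≤_) shift (linked (noCycle separate linked′))) ,
      (λ unlinked′ → trans (unlinked (unlinked′ ∘ mono)) shift)
      where
      shift : suc c + length S ≡ c + length (a ∷ S)
      shift = sym (ℕP.+-suc c (length S))
      separate : ¬ Star (WithEdgesTo S) v a
      separate = different ∘ Equivalence.from (proj₂ (proj₂ C) v a)
      mono : LinkedIn S → LinkedIn (a ∷ S)
      mono (b , b′ , b∈S , b′∈S , b≢b′ , path) = b , b′ , there b∈S , there b′∈S , b≢b′ , path

  isNeighbour : Fin (suc n) → Bool
  isNeighbour w = isEdge (edge G v w)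

  neighbours : List (Fin (suc n))
  neighbours = trueIndices isNeighbour

  ∈-neighbours⁻ : ∀ {w} → w ∈ neighbours → Adj G v w
  ∈-neighbours⁻ w∈ = isEdge≡true⇒≢none _ (trueIndices-sound isNeighbour w∈)

  ∈-neighbours⁺ : ∀ {w} → Adj G v w → w ∈ neighbours
  ∈-neighbours⁺ vw = trueIndices-complete isNeighbour (≢none⇒isEdge≡true _ vw)

  withNeighbours⇔adj : WithEdgesTo neighbours ⇒ Adj G × Adj G ⇒ WithEdgesTo neighbours
  withNeighbours⇔adj = to , from
    where
    to : WithEdgesTo neighbours ⇒ Adj G
    to (inj₁ (uw , _ , _))           = uw
    to (inj₂ (inj₁ (refl , w∈)))     = ∈-neighbours⁻ w∈
    to (inj₂ (inj₂ (refl , u∈)))     = adj-sym G (∈-neighbours⁻ u∈)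
    from : Adj G ⇒ WithEdgesTo neighbours
    from {u} {w} uw with u FP.≟ v | w FP.≟ v
    ... | yes refl | _        = inj₂ (inj₁ (refl , ∈-neighbours⁺ uw))
    ... | no _     | yes refl = inj₂ (inj₂ (refl , ∈-neighbours⁺ (adj-sym G uw)))
    ... | no u≢v   | no w≢v   = inj₁ (uw , u≢v , w≢v)

  vertexLemma : ∀ {ω′} → HasComponents (Adj G′) ω′ →
    Σ[ ω ∈ ℕ ] HasComponents (Adj G) ω × suc ω′ ≤ ω + degree G v ×
      (CycleThrough G v → 2 + ω′ ≤ ω + degree G v) × (¬ CycleThrough G v → suc ω′ ≡ ω + degree G v)
  vertexLemma {ω′} C′
    with addEdgesTo C′ neighbours (trueIndices-unique isNeighbour) ∈-neighbours⁻
  ... | c , C , below , linked , unlinked =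
    c , hasComponents-resp (proj₁ withNeighbours⇔adj) (proj₂ withNeighbours⇔adj) C ,
    subst (λ d → suc ω′ ≤ c + d) degree≡ below ,
    (λ cyc → subst (λ d → 2 + ω′ ≤ c + d) degree≡ (linked (toLinked cyc))) ,
    (λ ¬cyc → trans (unlinked (¬cyc ∘ fromLinked)) (cong (c +_) degree≡))
    where
    degree≡ : length neighbours ≡ degree G v
    degree≡ = trueIndices-length isNeighbour
    toLinked : CycleThrough G v → LinkedIn neighbours
    toLinked (a , b , va , vb , a≢b , path) = a , b , ∈-neighbours⁺ va , ∈-neighbours⁺ vb , a≢b , path
    fromLinked : LinkedIn neighbours → CycleThrough G v
    fromLinked (a , b , a∈ , b∈ , a≢b , path) = a , b , ∈-neighbours⁻ a∈ , ∈-neighbours⁻ b∈ , a≢b , path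

hasComponents-exists : ∀ {n} (G : MixedGraph n) → Σ[ ω ∈ ℕ ] HasComponents (Adj G) ω
hasComponents-exists {zero}  G = 0 , (λ ()) , (λ ()) , (λ ())
hasComponents-exists {suc n} G with VertexDeletion.vertexLemma G zero (proj₂ (hasComponents-exists (deleteVertex G zero)))
... | ω , C , _ = ω , C

module _ {n} (G : MixedGraph (suc n)) (v : Fin (suc n)) {ω′ ω}
         (C′ : HasComponents (Adj (deleteVertex G v)) ω′) (C : HasComponents (Adj G) ω) where

  components-deleteVertex : suc ω′ ≤ ω + degree G v
  components-deleteVertex with VertexDeletion.vertexLemma G v C′
  ... | _ , C₀ , below , _ = subst (λ c → suc ω′ ≤ c + degree G v) (hasComponents-unique C₀ C) below

  components-deleteVertex-cycle : CycleThrough G v → 2 + ω′ ≤ ω + degree G v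
  components-deleteVertex-cycle cyc with VertexDeletion.vertexLemma G v C′
  ... | _ , C₀ , _ , linked , _ = subst (λ c → 2 + ω′ ≤ c + degree G v) (hasComponents-unique C₀ C) (linked cyc)

  components-deleteVertex-acyclic : ¬ CycleThrough G v → suc ω′ ≡ ω + degree G v
  components-deleteVertex-acyclic ¬cyc with VertexDeletion.vertexLemma G v C′
  ... | _ , C₀ , _ , _ , unlinked = trans (unlinked ¬cyc) (cong (_+ degree G v) (hasComponents-unique C₀ C))

-- Counting edges

sumℕ-cong : ∀ {k} {f g : Fin k → ℕ} → (∀ i → f i ≡ g i) → sumℕ f ≡ sumℕ g
sumℕ-cong {zero}  f≗g = refl
sumℕ-cong {suc k} f≗g = cong₂ _+_ (f≗g zero) (sumℕ-cong (f≗g ∘ suc))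

sumℕ-+ : ∀ {k} (f g : Fin k → ℕ) → sumℕ (λ i → f i + g i) ≡ sumℕ f + sumℕ g
sumℕ-+ {zero}  f g = refl
sumℕ-+ {suc k} f g = trans (cong ((f zero + g zero) +_) (sumℕ-+ (f ∘ suc) (g ∘ suc)))
  (CommutativeSemigroupProperties.interchange ℕP.+-commutativeSemigroup (f zero) (g zero) _ _)

sumℕ-punchIn : ∀ {k} (f : Fin (suc k) → ℕ) c → sumℕ f ≡ f c + sumℕ (f ∘ punchIn c)
sumℕ-punchIn         f zero    = refl
sumℕ-punchIn {suc k} f (suc c) = trans (cong (f zero +_) (sumℕ-punchIn (f ∘ suc) c))
  (CommutativeSemigroupProperties.x∙yz≈y∙xz ℕP.+-commutativeSemigroup (f zero) (f (suc c)) _)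

sumℕ-≥ : ∀ {k} m (f : Fin k → ℕ) → (∀ i → m ≤ f i) → k * m ≤ sumℕ f
sumℕ-≥ {zero}  m f m≤f = z≤n
sumℕ-≥ {suc k} m f m≤f = ℕP.+-mono-≤ (m≤f zero) (sumℕ-≥ m (f ∘ suc) (m≤f ∘ suc))

upper : ∀ {k} → (Fin k → Fin k → ℕ) → Fin k → Fin k → ℕ
upper f u w = if toℕ u ℕ.<ᵇ toℕ w then f u w else 0

-- Splitting off u = 0, row 0 and column 0 contribute equally on the left, while on the
-- right only row 0 lies in the upper triangle.
sumℕ-symmetric : ∀ {k} (f : Fin k → Fin k → ℕ) → (∀ u w → f u w ≡ f w u) → (∀ u → f u u ≡ 0) →
  sumℕ (λ u → sumℕ (f u)) ≡ 2 * sumℕ (λ u → sumℕ (upper f u))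
sumℕ-symmetric {zero}  f f-sym f-diag = refl
sumℕ-symmetric {suc k} f f-sym f-diag = begin
  (f zero zero + row₀) + sumℕ (λ u → f (suc u) zero + sumℕ (f (suc u) ∘ suc))
    ≡⟨ cong₂ _+_ (cong (_+ row₀) (f-diag zero)) (sumℕ-+ (λ u → f (suc u) zero) (λ u → sumℕ (f (suc u) ∘ suc))) ⟩
  row₀ + (sumℕ (λ u → f (suc u) zero) + sumℕ (λ u → sumℕ (f (suc u) ∘ suc)))
    ≡⟨ cong₂ (λ s t → row₀ + (s + t)) (sumℕ-cong (λ u → f-sym (suc u) zero))
         (sumℕ-symmetric (λ u w → f (suc u) (suc w)) (λ u w → f-sym (suc u) (suc w)) (f-diag ∘ suc)) ⟩
  row₀ + (row₀ + 2 * rest)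
    ≡⟨ twice row₀ rest ⟩
  2 * (row₀ + rest) ∎
  where
  open ≡-Reasoning
  row₀ = sumℕ (f zero ∘ suc)
  rest = sumℕ (λ u → sumℕ (upper f (suc u) ∘ suc))
  twice : ∀ a r → a + (a + 2 * r) ≡ 2 * (a + r)
  twice = solve-∀

edgeIndicator : ∀ {n} → MixedGraph n → Fin n → Fin n → ℕ
edgeIndicator G u w = indicator (isEdge (edge G u w))

isEdge-reverseKind : ∀ k → isEdge (reverseKind k) ≡ isEdge k
isEdge-reverseKind none       = refl
isEdge-reverseKind undirected = refl
isEdge-reverseKind forward    = refl
isEdge-reverseKind backward   = refl

edgeIndicator-sym : ∀ {n} (G : MixedGraph n) u w → edgeIndicator G u w ≡ edgeIndicator G w u
edgeIndicator-sym G u w =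
  cong indicator (trans (sym (isEdge-reverseKind (edge G u w))) (cong isEdge (sym (symm G u w))))

edgeIndicator-diag : ∀ {n} (G : MixedGraph n) u → edgeIndicator G u u ≡ 0
edgeIndicator-diag G u = cong (indicator ∘ isEdge) (loopless G u)

degreeSum≡2*numEdges : ∀ {n} (G : MixedGraph n) → sumℕ (degree G) ≡ 2 * numEdges G
degreeSum≡2*numEdges G = sumℕ-symmetric (edgeIndicator G) (edgeIndicator-sym G) (edgeIndicator-diag G)

degreeSum-deleteVertex : ∀ {n} (G : MixedGraph (suc n)) v →
  sumℕ (degree G) ≡ sumℕ (degree (deleteVertex G v)) + 2 * degree G v
degreeSum-deleteVertex G v = begin
  sumℕ (degree G)
    ≡⟨ sumℕ-punchIn (degree G) v ⟩
  degree G v + sumℕ (degree G ∘ punchIn v)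
    ≡⟨ cong (degree G v +_) (sumℕ-cong (λ u → sumℕ-punchIn (edgeIndicator G (punchIn v u)) v)) ⟩
  degree G v + sumℕ (λ u → edgeIndicator G (punchIn v u) v + degree (deleteVertex G v) u)
    ≡⟨ cong (degree G v +_) (sumℕ-+ (λ u → edgeIndicator G (punchIn v u) v) (degree (deleteVertex G v))) ⟩
  degree G v + (sumℕ (λ u → edgeIndicator G (punchIn v u) v) + sumℕ (degree (deleteVertex G v)))
    ≡⟨ cong (λ d → degree G v + (d + sumℕ (degree (deleteVertex G v)))) column-v ⟩
  degree G v + (degree G v + sumℕ (degree (deleteVertex G v)))
    ≡⟨ rearrange (degree G v) _ ⟩
  sumℕ (degree (deleteVertex G v)) + 2 * degree G v ∎
  where
  open ≡-Reasoning
  column-v : sumℕ (λ u → edgeIndicator G (punchIn v u) v) ≡ degree G v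
  column-v = trans (sumℕ-cong (λ u → edgeIndicator-sym G (punchIn v u) v))
                   (sym (trans (sumℕ-punchIn (edgeIndicator G v) v)
                               (cong (_+ sumℕ (edgeIndicator G v ∘ punchIn v)) (edgeIndicator-diag G v))))
  rearrange : ∀ d s → d + (d + s) ≡ s + 2 * d
  rearrange = solve-∀

numEdges-deleteVertex : ∀ {n} (G : MixedGraph (suc n)) v →
  numEdges G ≡ numEdges (deleteVertex G v) + degree G v
numEdges-deleteVertex G v = ℕP.*-cancelˡ-≡ (numEdges G) (numEdges (deleteVertex G v) + degree G v) 2 (begin
  2 * numEdges G                                          ≡⟨ sym (degreeSum≡2*numEdges G) ⟩
  sumℕ (degree G)                                         ≡⟨ degreeSum-deleteVertex G v ⟩
  sumℕ (degree (deleteVertex G v)) + 2 * degree G v       ≡⟨ cong (_+ 2 * degree G v) (degreeSum≡2*numEdges (deleteVertex G v)) ⟩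
  2 * numEdges (deleteVertex G v) + 2 * degree G v        ≡⟨ sym (ℕP.*-distribˡ-+ 2 (numEdges (deleteVertex G v)) (degree G v)) ⟩
  2 * (numEdges (deleteVertex G v) + degree G v)          ∎)
  where open ≡-Reasoning

-- Forests

Acyclic : ∀ {n} → MixedGraph n → Set
Acyclic G = ∀ v → ¬ CycleThrough G v

cycleThrough-deleteVertex : ∀ {n} (G : MixedGraph (suc n)) v w →
  CycleThrough (deleteVertex G v) w → CycleThrough G (punchIn v w)
cycleThrough-deleteVertex G v w (a , b , wa , wb , a≢b , path) =
  punchIn v a , punchIn v b , wa , wb , a≢b ∘ FP.punchIn-injective v a b ,
  Star.gmap (punchIn v) (λ {s} {t} (st , s≢w , t≢w) →
    st , s≢w ∘ FP.punchIn-injective v s w , t≢w ∘ FP.punchIn-injective v t w) path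

acyclic-deleteVertex : ∀ {n} (G : MixedGraph (suc n)) v → Acyclic G → Acyclic (deleteVertex G v)
acyclic-deleteVertex G v acyclic w = acyclic (punchIn v w) ∘ cycleThrough-deleteVertex G v w

cycleThrough? : ∀ {n} (G : MixedGraph (suc n)) v → Dec (CycleThrough G v)
cycleThrough? G v = FP.any? λ a → FP.any? λ b →
  adj? G v a ×-dec adj? G v b ×-dec ¬? (a FP.≟ b) ×-dec linked? away a b
  where
  away = VertexDeletion.hasComponents-away G v (proj₂ (hasComponents-exists (deleteVertex G v)))

acyclic⇒numEdges+components≡n : ∀ {n} (G : MixedGraph n) {ω} → Acyclic G → HasComponents (Adj G) ω →
  numEdges G + ω ≡ n
acyclic⇒numEdges+components≡n {zero} G {zero}  _ _                = refl
acyclic⇒numEdges+components≡n {zero} G {suc ω} _ (_ , f-onto , _) = ⊥-elim (FP.¬Fin0 (proj₁ (f-onto zero)))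
acyclic⇒numEdges+components≡n {suc n} G {ω} acyclic C = begin
  numEdges G + ω         ≡⟨ cong (_+ ω) (numEdges-deleteVertex G zero) ⟩
  (E′ + d) + ω           ≡⟨ reorder E′ d ω ⟩
  E′ + (ω + d)           ≡⟨ cong (E′ +_) (sym (components-deleteVertex-acyclic G zero C′ C (acyclic zero))) ⟩
  E′ + suc ω′            ≡⟨ ℕP.+-suc E′ ω′ ⟩
  suc (E′ + ω′)          ≡⟨ cong suc (acyclic⇒numEdges+components≡n G′ (acyclic-deleteVertex G zero acyclic) C′) ⟩
  suc n                  ∎
  where
  open ≡-Reasoning
  G′ = deleteVertex G zero
  E′ = numEdges G′
  d  = degree G zero
  ω′ = proj₁ (hasComponents-exists G′)
  C′ = proj₂ (hasComponents-exists G′)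
  reorder : ∀ e d w → (e + d) + w ≡ e + (w + d)
  reorder = solve-∀

acyclic⇒leaf : ∀ {n} (G : MixedGraph (suc n)) → Acyclic G → Σ[ v ∈ Fin (suc n) ] degree G v < 2
acyclic⇒leaf {n} G acyclic = decidable-stable (FP.any? (λ v → degree G v ℕ.<? 2)) λ noLeaf →
  noComponents (ℕP.+-cancelˡ-≤ E ω 0 (subst₂ _≤_ (sym (acyclic⇒numEdges+components≡n G acyclic C))
                                                (sym (ℕP.+-identityʳ E)) (n≤E noLeaf)))
               (proj₁ C zero)
  where
  E = numEdges G
  ω = proj₁ (hasComponents-exists G)
  C = proj₂ (hasComponents-exists G)
  n≤E : ¬ (Σ[ v ∈ Fin (suc n) ] degree G v < 2) → suc n ≤ E
  n≤E noLeaf = ℕP.*-cancelˡ-≤ 2 (subst₂ _≤_ (ℕP.*-comm (suc n) 2) (degreeSum≡2*numEdges G)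
    (sumℕ-≥ 2 (degree G) (λ v → ℕP.≮⇒≥ (λ deg<2 → noLeaf (v , deg<2)))))
  noComponents : ∀ {m} → m ≤ 0 → ¬ Fin m
  noComponents z≤n ()

<2⇒≡0⊎≡1 : ∀ {m} → m < 2 → m ≡ 0 ⊎ m ≡ 1
<2⇒≡0⊎≡1 (s≤s z≤n)       = inj₁ refl
<2⇒≡0⊎≡1 (s≤s (s≤s z≤n)) = inj₂ refl

cycle-or-leaf : ∀ {n} (G : MixedGraph (suc n)) →
  (Σ[ v ∈ Fin (suc n) ] CycleThrough G v) ⊎ (Σ[ v ∈ Fin (suc n) ] degree G v ≡ 0) ⊎ (Σ[ v ∈ Fin (suc n) ] degree G v ≡ 1)
cycle-or-leaf G with FP.any? (cycleThrough? G)
... | yes cycle   = inj₁ cycle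
... | no  noCycle with acyclic⇒leaf G (λ v cyc → noCycle (v , cyc))
...   | v , deg<2 = inj₂ (Sum.map (v ,_) (v ,_) (<2⇒≡0⊎≡1 deg<2))

module _ {n} (G : MixedGraph (suc n)) (v : Fin (suc n)) where
  open VertexDeletion G v using (neighbours; ∈-neighbours⁺; ∈-neighbours⁻; isNeighbour)

  degree≡0⇒isolated : degree G v ≡ 0 → ∀ w → edge G v w ≡ none
  degree≡0⇒isolated deg≡0 w = decidable-stable (edge G v w ≟ᴱ none) λ vw →
    noMember neighbours (trans (trueIndices-length isNeighbour) deg≡0) (∈-neighbours⁺ vw)
    where
    noMember : ∀ xs → length xs ≡ 0 → w ∉ xs
    noMember [] _ ()

  degree≡1⇒pendant : degree G v ≡ 1 → Σ[ y ∈ Fin (suc n) ] Adj G v y × (∀ w → Adj G v w → w ≡ y)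
  degree≡1⇒pendant deg≡1 =
    single neighbours (trans (trueIndices-length isNeighbour) deg≡1) ∈-neighbours⁺ ∈-neighbours⁻
    where
    single : ∀ xs → length xs ≡ 1 → (∀ {w} → Adj G v w → w ∈ xs) → (∀ {w} → w ∈ xs → Adj G v w) →
      Σ[ y ∈ Fin (suc n) ] Adj G v y × (∀ w → Adj G v w → w ≡ y)
    single (y ∷ []) _ complete sound = y , sound (here refl) , λ w vw → only (complete vw)
      where
      only : ∀ {w} → w ∈ y ∷ [] → w ≡ y
      only (here w≡y) = w≡y

hEntry-isUnit : ∀ k → k ≢ none → IsUnit (hEntry k)
hEntry-isUnit none       k≢none = ⊥-elim (k≢none refl)
hEntry-isUnit undirected _      = 1-isUnit
hEntry-isUnit forward    _      = i-isUnit
hEntry-isUnit backward   _      = -i-isUnit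

aEntry : EdgeKind → GI
aEntry k = if isEdge k then 1ᴳ else 0ᴳ

aEntry-isUnit : ∀ k → k ≢ none → IsUnit (aEntry k)
aEntry-isUnit k k≢none rewrite ≢none⇒isEdge≡true k k≢none = 1-isUnit

-- A pendant vertex x with neighbour y

module PendantVertex {n} (G : MixedGraph (suc (suc n))) (x y : Fin (suc (suc n))) (xy : Adj G x y)
                     (pendant : ∀ w → Adj G x w → w ≡ y) where

  x≢y : x ≢ y
  x≢y = adj⇒≢ G xy

  G₁ : MixedGraph (suc n)
  G₁ = deleteVertex G x

  y′ : Fin (suc n)
  y′ = punchOut x≢y

  G′ : MixedGraph n
  G′ = deleteTwo G x y x≢y

  edge-x : ∀ w → w ≢ y → edge G x w ≡ none
  edge-x w w≢y = decidable-stable (edge G x w ≟ᴱ none) (w≢y ∘ pendant w)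

  edge-to-x : ∀ w → w ≢ y → edge G w x ≡ none
  edge-to-x w w≢y = trans (symm G x w) (cong reverseKind (edge-x w w≢y))

  module Hermitian = PendantIndex (H G) x y x≢y
    (λ w w≢y → cong hEntry (edge-x w w≢y)) (λ w w≢y → cong hEntry (edge-to-x w w≢y))
    (hEntry-isUnit _ xy) (hEntry-isUnit _ (adj-sym G xy))

  module Adjacency = PendantIndex (A G) x y x≢y
    (λ w w≢y → cong aEntry (edge-x w w≢y)) (λ w w≢y → cong aEntry (edge-to-x w w≢y))
    (aEntry-isUnit _ xy) (aEntry-isUnit _ (adj-sym G xy))

  degree-x : degree G x ≡ 1
  degree-x = trans (sumℕ-punchIn (edgeIndicator G x) y) (cong₂ _+_
    (cong indicator (≢none⇒isEdge≡true _ xy))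
    (trans (sumℕ-cong (λ j → cong (indicator ∘ isEdge) (edge-x (punchIn y j) (FP.punchInᵢ≢i y j)))) (sumℕ-zero n)))
    where
    sumℕ-zero : ∀ k → sumℕ {k} (λ _ → 0) ≡ 0
    sumℕ-zero zero    = refl
    sumℕ-zero (suc k) = sumℕ-zero k

  ¬cycleThrough-x : ¬ CycleThrough G x
  ¬cycleThrough-x (a , b , xa , xb , a≢b , _) = a≢b (trans (pendant a xa) (sym (pendant b xb)))

  numEdges-pendant : numEdges G ≡ (numEdges G′ + degree G₁ y′) + 1
  numEdges-pendant = trans (numEdges-deleteVertex G x) (cong₂ _+_ (numEdges-deleteVertex G₁ y′) degree-x)

  components-deletePendant : ∀ {ω ω₁} → HasComponents (Adj G) ω → HasComponents (Adj G₁) ω₁ → ω₁ ≡ ω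
  components-deletePendant {ω} C C₁ = ℕP.suc-injective (trans
    (components-deleteVertex-acyclic G x C₁ C ¬cycleThrough-x) (trans (cong (ω +_) degree-x) (ℕP.+-comm ω 1)))

  private
    unpunch-x : ∀ u → u ≢ x → Fin (suc n)
    unpunch-x u u≢x = punchOut (u≢x ∘ sym)

    punchIn-unpunch-x : ∀ u u≢x → punchIn x (unpunch-x u u≢x) ≡ u
    punchIn-unpunch-x u u≢x = FP.punchIn-punchOut (u≢x ∘ sym)

    unpunch-x≢y′ : ∀ u u≢x → u ≢ y → unpunch-x u u≢x ≢ y′
    unpunch-x≢y′ u u≢x u≢y eq =
      u≢y (trans (sym (punchIn-unpunch-x u u≢x)) (trans (cong (punchIn x) eq) (FP.punchIn-punchOut x≢y)))

  -- x has no neighbour but y, so a walk avoiding y never enters x.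
  walk-deletePendant : ∀ {u w} → Star (AdjAvoiding G y) u w → (u≢x : u ≢ x) →
    Σ[ w≢x ∈ w ≢ x ] Star (AdjAvoiding G₁ y′) (unpunch-x u u≢x) (unpunch-x w w≢x)
  walk-deletePendant ε u≢x = u≢x , ε
  walk-deletePendant {u} (_◅_ {j = v} (uv , u≢y , v≢y) walk) u≢x =
    proj₁ rest , (uv′ , unpunch-x≢y′ u u≢x u≢y , unpunch-x≢y′ v v≢x v≢y) ◅ proj₂ rest
    where
    v≢x : v ≢ x
    v≢x refl = u≢y (pendant u (adj-sym G uv))
    rest = walk-deletePendant walk v≢x
    uv′ : Adj G₁ (unpunch-x u u≢x) (unpunch-x v v≢x)
    uv′ e = uv (subst₂ (λ s t → edge G s t ≡ none) (punchIn-unpunch-x u u≢x) (punchIn-unpunch-x v v≢x) e)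

  walk-start≢x : ∀ {a b} → Star (AdjAvoiding G y) a b → a ≢ b → a ≢ x
  walk-start≢x ε                    a≢a _    = a≢a refl
  walk-start≢x ((xt , _ , t≢y) ◅ _) _   refl = t≢y (pendant _ xt)

  cycleThrough-deletePendant : CycleThrough G y ⇔ CycleThrough G₁ y′
  cycleThrough-deletePendant = mk⇔ to from
    where
    to : CycleThrough G y → CycleThrough G₁ y′
    to (a , b , ya , yb , a≢b , walk) =
      unpunch-x a a≢x , unpunch-x b b≢x , neighbour a≢x ya , neighbour b≢x yb ,
      (λ eq → a≢b (trans (sym (punchIn-unpunch-x a a≢x)) (trans (cong (punchIn x) eq) (punchIn-unpunch-x b b≢x)))) ,
      proj₂ (walk-deletePendant walk a≢x)
      where
      a≢x = walk-start≢x walk a≢b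
      b≢x = proj₁ (walk-deletePendant walk a≢x)
      neighbour : ∀ {t} (t≢x : t ≢ x) → Adj G y t → Adj G₁ y′ (unpunch-x t t≢x)
      neighbour t≢x yt = subst₂ (Adj G) (sym (FP.punchIn-punchOut x≢y)) (sym (punchIn-unpunch-x _ t≢x)) yt
    from : CycleThrough G₁ y′ → CycleThrough G y
    from = subst (CycleThrough G) (FP.punchIn-punchOut x≢y) ∘ cycleThrough-deleteVertex G x y′

-- The rank bound rk(H) − r(A) ≤ 2 d(G)

RankBound : ∀ {n} → MixedGraph n → Set
RankBound {n} G = ∀ {ω k} → HasComponents (Adj G) ω → NonzeroMinor (H G) k →
  Σ[ k′ ∈ ℕ ] NonzeroMinor (A G) k′ × k + 2 * n ≤ k′ + 2 * (numEdges G + ω)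

bound-cycle-arith : ∀ {k k₂ n k″ E′ ω′ ω d} → k ≤ 2 + k₂ → k₂ + 2 * n ≤ k″ + 2 * (E′ + ω′) →
  2 + ω′ ≤ ω + d → k + 2 * suc n ≤ k″ + 2 * ((E′ + d) + ω)
bound-cycle-arith {k} {k₂} {n} {k″} {E′} {ω′} {ω} {d} k≤ bound′ components≤ = begin
  k + 2 * suc n                  ≤⟨ ℕP.+-monoˡ-≤ (2 * suc n) k≤ ⟩
  (2 + k₂) + 2 * suc n           ≡⟨ shift₁ k₂ n ⟩
  (k₂ + 2 * n) + 4               ≤⟨ ℕP.+-monoˡ-≤ 4 bound′ ⟩
  (k″ + 2 * (E′ + ω′)) + 4       ≡⟨ shift₂ k″ E′ ω′ ⟩
  k″ + 2 * (E′ + (2 + ω′))       ≤⟨ ℕP.+-monoʳ-≤ k″ (ℕP.*-monoʳ-≤ 2 (ℕP.+-monoʳ-≤ E′ components≤)) ⟩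
  k″ + 2 * (E′ + (ω + d))        ≡⟨ shift₃ k″ E′ ω d ⟩
  k″ + 2 * ((E′ + d) + ω)        ∎
  where
  open ℕP.≤-Reasoning
  shift₁ : ∀ k₂ n → (2 + k₂) + 2 * suc n ≡ (k₂ + 2 * n) + 4
  shift₁ = solve-∀
  shift₂ : ∀ k″ E′ ω′ → (k″ + 2 * (E′ + ω′)) + 4 ≡ k″ + 2 * (E′ + (2 + ω′))
  shift₂ = solve-∀
  shift₃ : ∀ k″ E′ ω d → k″ + 2 * (E′ + (ω + d)) ≡ k″ + 2 * ((E′ + d) + ω)
  shift₃ = solve-∀

bound-isolated-arith : ∀ {k n k″ E′ ω′ ω} → k + 2 * n ≤ k″ + 2 * (E′ + ω′) → suc ω′ ≡ ω + 0 →
  k + 2 * suc n ≤ k″ + 2 * ((E′ + 0) + ω)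
bound-isolated-arith {k} {n} {k″} {E′} {ω′} {ω} bound′ components≡ = begin
  k + 2 * suc n                  ≡⟨ shift₁ k n ⟩
  (k + 2 * n) + 2                ≤⟨ ℕP.+-monoˡ-≤ 2 bound′ ⟩
  (k″ + 2 * (E′ + ω′)) + 2       ≡⟨ shift₂ k″ E′ ω′ ⟩
  k″ + 2 * ((E′ + 0) + suc ω′)   ≡⟨ cong (λ c → k″ + 2 * ((E′ + 0) + c)) (trans components≡ (ℕP.+-identityʳ ω)) ⟩
  k″ + 2 * ((E′ + 0) + ω)        ∎
  where
  open ℕP.≤-Reasoning
  shift₁ : ∀ k n → k + 2 * suc n ≡ (k + 2 * n) + 2
  shift₁ = solve-∀
  shift₂ : ∀ k″ E′ ω′ → (k″ + 2 * (E′ + ω′)) + 2 ≡ k″ + 2 * ((E′ + 0) + suc ω′)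
  shift₂ = solve-∀

bound-pendant-arith : ∀ {k k₂ m k″ E′ ω′ ω d} → k ≤ 2 + k₂ → k₂ + 2 * m ≤ k″ + 2 * (E′ + ω′) →
  suc ω′ ≤ ω + d → k + 2 * (2 + m) ≤ (2 + k″) + 2 * (((E′ + d) + 1) + ω)
bound-pendant-arith {k} {k₂} {m} {k″} {E′} {ω′} {ω} {d} k≤ bound′ components≤ = begin
  k + 2 * (2 + m)                     ≤⟨ ℕP.+-monoˡ-≤ (2 * (2 + m)) k≤ ⟩
  (2 + k₂) + 2 * (2 + m)              ≡⟨ shift₁ k₂ m ⟩
  (k₂ + 2 * m) + 6                    ≤⟨ ℕP.+-monoˡ-≤ 6 bound′ ⟩
  (k″ + 2 * (E′ + ω′)) + 6            ≡⟨ shift₂ k″ E′ ω′ ⟩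
  (2 + k″) + 2 * ((E′ + 1) + suc ω′)  ≤⟨ ℕP.+-monoʳ-≤ (2 + k″) (ℕP.*-monoʳ-≤ 2 (ℕP.+-monoʳ-≤ (E′ + 1) components≤)) ⟩
  (2 + k″) + 2 * ((E′ + 1) + (ω + d)) ≡⟨ shift₃ k″ E′ ω d ⟩
  (2 + k″) + 2 * (((E′ + d) + 1) + ω) ∎
  where
  open ℕP.≤-Reasoning
  shift₁ : ∀ k₂ m → (2 + k₂) + 2 * (2 + m) ≡ (k₂ + 2 * m) + 6
  shift₁ = solve-∀
  shift₂ : ∀ k″ E′ ω′ → (k″ + 2 * (E′ + ω′)) + 6 ≡ (2 + k″) + 2 * ((E′ + 1) + suc ω′)
  shift₂ = solve-∀
  shift₃ : ∀ k″ E′ ω d → (2 + k″) + 2 * ((E′ + 1) + (ω + d)) ≡ (2 + k″) + 2 * (((E′ + d) + 1) + ω)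
  shift₃ = solve-∀

-- Deleting a vertex on a cycle costs H at most two in rank and lowers d(G) by at least one.
rankBound-cycle : ∀ {n} (G : MixedGraph (suc n)) v → CycleThrough G v → RankBound (deleteVertex G v) → RankBound G
rankBound-cycle {n} G v cycle bound′ {ω} {k} C X =
  let ω′ , C′        = hasComponents-exists G′
      k″ , Y , k≤k″ = bound′ C′ (nonzeroMinor-deleteIndex (H G) v X)
  in k″ , nonzeroMinor-undeleteIndex (A G) v Y ,
     subst (λ E → k + 2 * suc n ≤ k″ + 2 * (E + ω)) (sym (numEdges-deleteVertex G v))
       (bound-cycle-arith {k″ = k″} {E′ = numEdges G′} {ω = ω} {d = degree G v}
         (ℕP.m≤n+m∸n k 2) k≤k″ (components-deleteVertex-cycle G v C′ C cycle))
  where G′ = deleteVertex G v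

rankBound-isolated : ∀ {n} (G : MixedGraph (suc n)) v → degree G v ≡ 0 → RankBound (deleteVertex G v) → RankBound G
rankBound-isolated {n} G v deg≡0 bound′ {ω} {k} C X =
  let ω′ , C′        = hasComponents-exists G′
      k″ , Y , k≤k″ = bound′ C′ (nonzeroMinor-deleteZeroIndex (H G) v (cong hEntry ∘ isolated) (cong hEntry ∘ isolated′) X)
  in k″ , nonzeroMinor-undeleteIndex (A G) v Y ,
     subst (λ E → k + 2 * suc n ≤ k″ + 2 * (E + ω)) (sym numEdges≡)
       (bound-isolated-arith {k″ = k″} {E′ = numEdges G′} {ω = ω} k≤k″
         (trans (components-deleteVertex-acyclic G v C′ C noCycle) (cong (ω +_) deg≡0)))
  where
  G′ = deleteVertex G v
  isolated : ∀ w → edge G v w ≡ none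
  isolated = degree≡0⇒isolated G v deg≡0
  isolated′ : ∀ w → edge G w v ≡ none
  isolated′ w = trans (symm G v w) (cong reverseKind (isolated w))
  noCycle : ¬ CycleThrough G v
  noCycle (a , _ , va , _) = va (isolated a)
  numEdges≡ : numEdges G ≡ numEdges G′ + 0
  numEdges≡ = trans (numEdges-deleteVertex G v) (cong (numEdges G′ +_) deg≡0)

-- Deleting a pendant vertex and its neighbour lowers both ranks by exactly two.
rankBound-pendant : ∀ {m} (G : MixedGraph (suc (suc m))) x y (xy : Adj G x y) → (∀ w → Adj G x w → w ≡ y) →
  RankBound (deleteTwo G x y (adj⇒≢ G xy)) → RankBound G
rankBound-pendant {m} G x y xy pendant bound′ {ω} {k} C X =
  let ω₁ , C₁        = hasComponents-exists G₁
      ω′ , C′        = hasComponents-exists G′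
      k″ , Y , k≤k″ = bound′ C′ (Hermitian.nonzeroMinor-drop X)
  in 2 + k″ , Adjacency.nonzeroMinor-lift Y ,
     subst (λ E → k + 2 * (2 + m) ≤ (2 + k″) + 2 * (E + ω)) (sym numEdges-pendant)
       (bound-pendant-arith {k″ = k″} {E′ = numEdges G′} {ω = ω} {d = degree G₁ y′} (ℕP.m≤n+m∸n k 2) k≤k″
         (subst (λ c → suc ω′ ≤ c + degree G₁ y′) (components-deletePendant C C₁) (components-deleteVertex G₁ y′ C′ C₁)))
  where open PendantVertex G x y xy pendant

rankBound-leaf : ∀ {n} (G : MixedGraph (suc n)) x → degree G x ≡ 1 →
  (∀ {m} → m < suc n → (G : MixedGraph m) → RankBound G) → RankBound G
rankBound-leaf {zero} G zero deg≡1 _ with degree≡1⇒pendant G zero deg≡1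
... | zero , xx , _ = ⊥-elim (adj-irrefl G xx)
rankBound-leaf {suc m} G x deg≡1 rec with degree≡1⇒pendant G x deg≡1
... | y , xy , pendant = rankBound-pendant G x y xy pendant (rec (ℕP.m<n⇒m<1+n (ℕP.n<1+n m)) (deleteTwo G x y (adj⇒≢ G xy)))

rankBound : ∀ {n} (G : MixedGraph n) → RankBound G
rankBound {n} = <-rec (λ n → (G : MixedGraph n) → RankBound G) induction n
  where
  induction : ∀ n → (∀ {m} → m < n → (G : MixedGraph m) → RankBound G) → (G : MixedGraph n) → RankBound G
  induction zero    _   G {k = zero}  _ _ = 0 , nonzeroMinor-0 , z≤n
  induction zero    _   G {k = suc k} _ X = ⊥-elim (FP.¬Fin0 (NonzeroMinorIn.rows X zero))
  induction (suc n) rec G with cycle-or-leaf G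
  ... | inj₁ (v , cycle)         = rankBound-cycle G v cycle (rec (ℕP.n<1+n n) (deleteVertex G v))
  ... | inj₂ (inj₁ (v , deg≡0)) = rankBound-isolated G v deg≡0 (rec (ℕP.n<1+n n) (deleteVertex G v))
  ... | inj₂ (inj₂ (x , deg≡1)) = rankBound-leaf G x deg≡1 rec

-- Cycles as vertex sequences

record SimplePath {N} (R : Rel (Fin N) 0ℓ) (a b : Fin N) : Set where
  constructor simplePath
  field
    len       : ℕ
    vertex    : Fin (suc len) → Fin N
    start     : vertex zero ≡ a
    end       : vertex (fromℕ len) ≡ b
    injective : Injective _≡_ _≡_ vertex
    steps     : ∀ (j : Fin len) → R (vertex (inject₁ j)) (vertex (suc j))

module _ {N} {R : Rel (Fin N) 0ℓ} where

  simplePath-suffix : ∀ {b} len (q : Fin (suc len) → Fin N) → q (fromℕ len) ≡ b → Injective _≡_ _≡_ q →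
    (∀ j → R (q (inject₁ j)) (q (suc j))) → ∀ k → SimplePath R (q k) b
  simplePath-suffix len       q end q-inj steps zero    = simplePath len q refl end q-inj steps
  simplePath-suffix (suc len) q end q-inj steps (suc k) =
    simplePath-suffix len (q ∘ suc) end (λ e → FP.suc-injective (q-inj e)) (steps ∘ suc) k

  -- The walk is cut short where it revisits its starting vertex.
  star⇒simplePath : ∀ {a b} → Star R a b → SimplePath R a b
  star⇒simplePath {a} ε = simplePath 0 (λ _ → a) refl refl (λ { {zero} {zero} _ → refl }) (λ ())
  star⇒simplePath {a} {b} (r ◅ walk) with star⇒simplePath walk
  ... | simplePath len q start end q-inj steps with FP.any? (λ k → q k FP.≟ a)
  ...   | yes (k , qk≡a) = subst (λ t → SimplePath R t b) qk≡a (simplePath-suffix len q end q-inj steps k)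
  ...   | no  a∉q        = simplePath (suc len) (a Vec.∷ q) refl end (∷-injective (λ i e → a∉q (i , e)) q-inj) steps′
    where
    steps′ : ∀ j → R ((a Vec.∷ q) (inject₁ j)) ((a Vec.∷ q) (suc j))
    steps′ zero    = subst (R a) (sym start) r
    steps′ (suc j) = steps j

  prefixPath : ∀ {len} (q : Fin (suc len) → Fin N) k →
    (∀ (j : Fin len) → toℕ j < toℕ k → R (q (inject₁ j)) (q (suc j))) → Star R (q zero) (q k)
  prefixPath         q zero    _     = ε
  prefixPath {suc _} q (suc k) steps = steps zero (s≤s z≤n) ◅ prefixPath (q ∘ suc) k (λ j j<k → steps (suc j) (s≤s j<k))

  suffixPath : ∀ {len} (q : Fin (suc len) → Fin N) k →
    (∀ (j : Fin len) → toℕ k ≤ toℕ j → R (q (inject₁ j)) (q (suc j))) → Star R (q k) (q (fromℕ len))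
  suffixPath {zero}  q zero    _     = ε
  suffixPath {suc _} q zero    steps = steps zero z≤n ◅ suffixPath (q ∘ suc) zero (λ j _ → steps (suc j) z≤n)
  suffixPath {suc _} q (suc k) steps = suffixPath (q ∘ suc) k (λ j k≤j → steps (suc j) (s≤s k≤j))

module _ {N} (G : MixedGraph N) where

  cycleThrough⇒onCycle : ∀ {y} → CycleThrough G y → OnCycle G y
  cycleThrough⇒onCycle {y} (a , b , ya , yb , a≢b , walk) with star⇒simplePath walk
  ... | simplePath zero    q start end _     _     = ⊥-elim (a≢b (trans (sym start) end))
  ... | simplePath (suc m) q start end q-inj steps =
    m , y Vec.∷ q , ∷-injective q≢y q-inj , steps′ , subst (λ t → Adj G t y) (sym end) (adj-sym G yb) , zero , refl
    where
    q≢y : ∀ i → q i ≢ y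
    q≢y zero    qi≡y = adj-irrefl G (subst (Adj G y) (trans (sym start) qi≡y) ya)
    q≢y (suc i) qi≡y = proj₂ (proj₂ (steps i)) qi≡y
    steps′ : ∀ j → Adj G ((y Vec.∷ q) (inject₁ j)) ((y Vec.∷ q) (suc j))
    steps′ zero    = subst (Adj G y) (sym start) ya
    steps′ (suc j) = proj₁ (steps j)

  -- The two cycle neighbours of y are joined along the rest of the cycle.
  onCycle⇒cycleThrough : ∀ {y} → OnCycle G y → CycleThrough G y
  onCycle⇒cycleThrough (m , c , c-inj , steps , closing , position , refl) = around position
    where
    L = suc (suc m)
    avoiding : ∀ i (j : Fin L) → inject₁ j ≢ i → suc j ≢ i → AdjAvoiding G (c i) (c (inject₁ j)) (c (suc j))
    avoiding i j j≢i j+1≢i = steps j , j≢i ∘ c-inj , j+1≢i ∘ c-inj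
    before : ∀ i (j : Fin L) → suc (toℕ j) < toℕ i → AdjAvoiding G (c i) (c (inject₁ j)) (c (suc j))
    before i j j+1<i = avoiding i j
      (λ e → ℕP.<⇒≢ (ℕP.<-trans (ℕP.n<1+n (toℕ j)) j+1<i) (trans (sym (FP.toℕ-inject₁ j)) (cong toℕ e)))
      (λ e → ℕP.<⇒≢ j+1<i (cong toℕ e))
    after : ∀ i (j : Fin L) → toℕ i < toℕ j → AdjAvoiding G (c i) (c (inject₁ j)) (c (suc j))
    after i j i<j = avoiding i j
      (λ e → ℕP.<⇒≢ i<j (sym (trans (sym (FP.toℕ-inject₁ j)) (cong toℕ e))))
      (λ e → ℕP.<⇒≢ (ℕP.<-trans i<j (ℕP.n<1+n (toℕ j))) (sym (cong toℕ e)))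
    around : ∀ i → CycleThrough G (c i)
    around zero = c (suc zero) , c (fromℕ L) , steps zero , adj-sym G closing , (λ e → case c-inj e of λ ()) ,
      suffixPath c (suc zero) (after zero)
    around (suc i′) with view i′
    ... | ‵fromℕ = c zero , c (inject₁ (fromℕ (suc m))) , closing , adj-sym G (steps (fromℕ (suc m))) ,
      (λ e → case c-inj e of λ ()) ,
      prefixPath c (inject₁ (fromℕ (suc m))) λ j j<k → before (suc (fromℕ (suc m))) j (begin-strict
        suc (toℕ j)                  ≤⟨ j<k ⟩
        toℕ (inject₁ (fromℕ (suc m))) ≡⟨ FP.toℕ-inject₁ (fromℕ (suc m)) ⟩
        toℕ (fromℕ (suc m))          <⟨ ℕP.n<1+n _ ⟩
        suc (toℕ (fromℕ (suc m)))    ∎)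
      where open ℕP.≤-Reasoning
    ... | ‵inject₁ j₀ = c (suc (suc j₀)) , c (inject₁ (inject₁ j₀)) , steps (suc j₀) , adj-sym G (steps (inject₁ j₀)) ,
      (λ e → ℕP.<⇒≢ (ℕP.m<n⇒m<1+n (ℕP.n<1+n (toℕ j₀)))
               (sym (trans (cong toℕ (c-inj e)) (trans (FP.toℕ-inject₁ (inject₁ j₀)) (FP.toℕ-inject₁ j₀))))) ,
      suffixPath c (suc (suc j₀))
        (λ j k≤j → after y-pos j (subst (λ t → suc (suc t) ≤ toℕ j) (sym (FP.toℕ-inject₁ j₀)) k≤j)) ◅◅
      (closing , (λ e → FP.fromℕ≢inject₁ (FP.suc-injective (c-inj e))) , (λ e → case c-inj e of λ ())) ◅
      prefixPath c (inject₁ (inject₁ j₀))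
        (λ j j<k → before y-pos j (s≤s (subst (suc (toℕ j) ≤_) (FP.toℕ-inject₁ (inject₁ j₀)) j<k)))
      where y-pos = suc (inject₁ j₀)

hasRank-bound : ∀ {n} (G : MixedGraph n) {rk r ω} → HasRank (H G) rk → HasRank (A G) r → HasComponents (Adj G) ω →
  rk + 2 * n ≤ r + 2 * (numEdges G + ω)
hasRank-bound G rank-H rank-A C =
  let k′ , Y , bound = rankBound G C (hasRank⇒nonzeroMinor rank-H)
  in ℕP.≤-trans bound (ℕP.+-monoˡ-≤ _ (hasRank⇒maximal rank-A Y))

-- Upper-optimality as an equation of natural numbers

Balanced : (rk r n E ω : ℕ) → Set
Balanced rk r n E ω = rk + 2 * n ≡ r + 2 * (E + ω)

integerForm⇔balanced : ∀ rk r n E ω →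
  (ℤ.+ rk ℤ.- ℤ.+ r ≡ ℤ.+ 2 ℤ.* ((ℤ.+ E ℤ.- ℤ.+ n) ℤ.+ ℤ.+ ω)) ⇔ Balanced rk r n E ω
integerForm⇔balanced rk r n E ω = mk⇔ to from
  where
  open ≡-Reasoning
  lhs-cast : ℤ.+ (rk + 2 * n) ≡ ℤ.+ rk ℤ.+ ℤ.+ 2 ℤ.* ℤ.+ n
  lhs-cast = trans (ℤP.pos-+ rk (2 * n)) (cong (λ t → ℤ.+ rk ℤ.+ t) (ℤP.pos-* 2 n))
  rhs-cast : ℤ.+ (r + 2 * (E + ω)) ≡ ℤ.+ r ℤ.+ ℤ.+ 2 ℤ.* (ℤ.+ E ℤ.+ ℤ.+ ω)
  rhs-cast = trans (ℤP.pos-+ r (2 * (E + ω)))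
    (cong (λ t → ℤ.+ r ℤ.+ t) (trans (ℤP.pos-* 2 (E + ω)) (cong (λ t → ℤ.+ 2 ℤ.* t) (ℤP.pos-+ E ω))))
  add-r : ∀ a b d → a ℤ.+ ℤ.+ 2 ℤ.* d ≡ ((a ℤ.- b) ℤ.+ b) ℤ.+ ℤ.+ 2 ℤ.* d
  add-r = ℤSolver.solve-∀
  collect : ∀ b c d e → (ℤ.+ 2 ℤ.* ((c ℤ.- d) ℤ.+ e) ℤ.+ b) ℤ.+ ℤ.+ 2 ℤ.* d ≡ b ℤ.+ ℤ.+ 2 ℤ.* (c ℤ.+ e)
  collect = ℤSolver.solve-∀
  add-2n : ∀ a b d → a ℤ.- b ≡ ((a ℤ.+ ℤ.+ 2 ℤ.* d) ℤ.- b) ℤ.- ℤ.+ 2 ℤ.* d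
  add-2n = ℤSolver.solve-∀
  separate : ∀ b c d e → ((b ℤ.+ ℤ.+ 2 ℤ.* (c ℤ.+ e)) ℤ.- b) ℤ.- ℤ.+ 2 ℤ.* d ≡ ℤ.+ 2 ℤ.* ((c ℤ.- d) ℤ.+ e)
  separate = ℤSolver.solve-∀
  to : ℤ.+ rk ℤ.- ℤ.+ r ≡ ℤ.+ 2 ℤ.* ((ℤ.+ E ℤ.- ℤ.+ n) ℤ.+ ℤ.+ ω) → Balanced rk r n E ω
  to eq = ℤP.+-injective (begin
    ℤ.+ (rk + 2 * n)
      ≡⟨ lhs-cast ⟩
    ℤ.+ rk ℤ.+ ℤ.+ 2 ℤ.* ℤ.+ n
      ≡⟨ add-r (ℤ.+ rk) (ℤ.+ r) (ℤ.+ n) ⟩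
    ((ℤ.+ rk ℤ.- ℤ.+ r) ℤ.+ ℤ.+ r) ℤ.+ ℤ.+ 2 ℤ.* ℤ.+ n
      ≡⟨ cong (λ t → (t ℤ.+ ℤ.+ r) ℤ.+ ℤ.+ 2 ℤ.* ℤ.+ n) eq ⟩
    (ℤ.+ 2 ℤ.* ((ℤ.+ E ℤ.- ℤ.+ n) ℤ.+ ℤ.+ ω) ℤ.+ ℤ.+ r) ℤ.+ ℤ.+ 2 ℤ.* ℤ.+ n
      ≡⟨ collect (ℤ.+ r) (ℤ.+ E) (ℤ.+ n) (ℤ.+ ω) ⟩
    ℤ.+ r ℤ.+ ℤ.+ 2 ℤ.* (ℤ.+ E ℤ.+ ℤ.+ ω)
      ≡⟨ rhs-cast ⟨
    ℤ.+ (r + 2 * (E + ω)) ∎)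
  from : Balanced rk r n E ω → ℤ.+ rk ℤ.- ℤ.+ r ≡ ℤ.+ 2 ℤ.* ((ℤ.+ E ℤ.- ℤ.+ n) ℤ.+ ℤ.+ ω)
  from eq = begin
    ℤ.+ rk ℤ.- ℤ.+ r
      ≡⟨ add-2n (ℤ.+ rk) (ℤ.+ r) (ℤ.+ n) ⟩
    ((ℤ.+ rk ℤ.+ ℤ.+ 2 ℤ.* ℤ.+ n) ℤ.- ℤ.+ r) ℤ.- ℤ.+ 2 ℤ.* ℤ.+ n
      ≡⟨ cong (λ t → (t ℤ.- ℤ.+ r) ℤ.- ℤ.+ 2 ℤ.* ℤ.+ n) (trans (sym lhs-cast) (trans (cong ℤ.+_ eq) rhs-cast)) ⟩
    ((ℤ.+ r ℤ.+ ℤ.+ 2 ℤ.* (ℤ.+ E ℤ.+ ℤ.+ ω)) ℤ.- ℤ.+ r) ℤ.- ℤ.+ 2 ℤ.* ℤ.+ n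
      ≡⟨ separate (ℤ.+ r) (ℤ.+ E) (ℤ.+ n) (ℤ.+ ω) ⟩
    ℤ.+ 2 ℤ.* ((ℤ.+ E ℤ.- ℤ.+ n) ℤ.+ ℤ.+ ω) ∎

-- Both sides of the equation for G exceed those for G′ by 6 when y is on no cycle.
balanced-pendant : ∀ {rk r n E ω rk′ r′ E′ ω′ d} → rk ≡ 2 + rk′ → r ≡ 2 + r′ → E ≡ (E′ + d) + 1 →
  suc ω′ ≡ ω + d → Balanced rk r (2 + n) E ω ⇔ Balanced rk′ r′ n E′ ω′
balanced-pendant {n = n} {ω = ω} {rk′} {r′} {E′} {ω′} {d} refl refl refl components≡ =
  mk⇔ (λ eq → ℕP.+-cancelʳ-≡ 6 _ _ (trans (sym (lhs rk′ n)) (trans eq rhs)))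
      (λ eq → trans (lhs rk′ n) (trans (cong (_+ 6) eq) (sym rhs)))
  where
  open ≡-Reasoning
  lhs : ∀ rk′ n → (2 + rk′) + 2 * (2 + n) ≡ (rk′ + 2 * n) + 6
  lhs = solve-∀
  split : ∀ r′ E′ d ω → (2 + r′) + 2 * (((E′ + d) + 1) + ω) ≡ (r′ + 2 * E′ + 4) + 2 * (ω + d)
  split = solve-∀
  join : ∀ r′ E′ ω′ → (r′ + 2 * E′ + 4) + 2 * suc ω′ ≡ (r′ + 2 * (E′ + ω′)) + 6
  join = solve-∀
  rhs : (2 + r′) + 2 * (((E′ + d) + 1) + ω) ≡ (r′ + 2 * (E′ + ω′)) + 6
  rhs = begin
    (2 + r′) + 2 * (((E′ + d) + 1) + ω)  ≡⟨ split r′ E′ d ω ⟩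
    (r′ + 2 * E′ + 4) + 2 * (ω + d)      ≡⟨ cong (λ c → (r′ + 2 * E′ + 4) + 2 * c) (sym components≡) ⟩
    (r′ + 2 * E′ + 4) + 2 * suc ω′       ≡⟨ join r′ E′ ω′ ⟩
    (r′ + 2 * (E′ + ω′)) + 6             ∎

-- With y on a cycle the right-hand side for G exceeds that for G′ by at least 8, the left by 6.
¬balanced-pendant-cycle : ∀ {rk r n E ω rk′ r′ E′ ω′ d} → rk ≡ 2 + rk′ → r ≡ 2 + r′ → E ≡ (E′ + d) + 1 →
  2 + ω′ ≤ ω + d → rk′ + 2 * n ≤ r′ + 2 * (E′ + ω′) → ¬ Balanced rk r (2 + n) E ω
¬balanced-pendant-cycle {n = n} {ω = ω} {rk′} {r′} {E′} {ω′} {d} refl refl refl components≤ bound′ eq =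
  ℕP.<⇒≱ (ℕP.+-monoʳ-< (rk′ + 2 * n) (ℕP.m<n⇒m<1+n (ℕP.n<1+n 6))) (begin
    (rk′ + 2 * n) + 8                    ≤⟨ ℕP.+-monoˡ-≤ 8 bound′ ⟩
    (r′ + 2 * (E′ + ω′)) + 8             ≡⟨ join r′ E′ ω′ ⟩
    (r′ + 2 * E′ + 4) + 2 * (2 + ω′)     ≤⟨ ℕP.+-monoʳ-≤ (r′ + 2 * E′ + 4) (ℕP.*-monoʳ-≤ 2 components≤) ⟩
    (r′ + 2 * E′ + 4) + 2 * (ω + d)      ≡⟨ split r′ E′ d ω ⟨
    (2 + r′) + 2 * (((E′ + d) + 1) + ω)  ≡⟨ eq ⟨
    (2 + rk′) + 2 * (2 + n)              ≡⟨ lhs rk′ n ⟩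
    (rk′ + 2 * n) + 6                    ∎)
  where
  open ℕP.≤-Reasoning
  lhs : ∀ rk′ n → (2 + rk′) + 2 * (2 + n) ≡ (rk′ + 2 * n) + 6
  lhs = solve-∀
  split : ∀ r′ E′ d ω → (2 + r′) + 2 * (((E′ + d) + 1) + ω) ≡ (r′ + 2 * E′ + 4) + 2 * (ω + d)
  split = solve-∀
  join : ∀ r′ E′ ω′ → (r′ + 2 * (E′ + ω′)) + 8 ≡ (r′ + 2 * E′ + 4) + 2 * (2 + ω′)
  join = solve-∀

reach⇔star : ∀ {n} {G : MixedGraph n} {u v} → Reach G u v ⇔ Star (Adj G) u v
reach⇔star = mk⇔ to from
  where
  to : ∀ {u v} → Reach _ u v → Star _ u v
  to here         = ε
  to (step uw wv) = uw ◅ to wv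
  from : ∀ {u v} → Star _ u v → Reach _ u v
  from ε          = here
  from (uw ◅ wv)  = step uw (from wv)

componentCount⇔hasComponents : ∀ {n} {G : MixedGraph n} {ω} → ComponentCount G ω ⇔ HasComponents (Adj G) ω
componentCount⇔hasComponents = mk⇔
  (λ (f , f-onto , same⇔reach) → f , f-onto , λ u v →
    mk⇔ (Equivalence.to reach⇔star ∘ Equivalence.to (same⇔reach u v))
        (Equivalence.from (same⇔reach u v) ∘ Equivalence.from reach⇔star))
  (λ (f , f-onto , same⇔linked) → f , f-onto , λ u v →
    mk⇔ (Equivalence.from reach⇔star ∘ Equivalence.to (same⇔linked u v))
        (Equivalence.from (same⇔linked u v) ∘ Equivalence.to reach⇔star))

UpperOptimalℕ : ∀ {n} → MixedGraph n → Set
UpperOptimalℕ {n} G = Σ[ rk ∈ ℕ ] Σ[ r ∈ ℕ ] Σ[ ω ∈ ℕ ]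
  HasRank (H G) rk × HasRank (A G) r × HasComponents (Adj G) ω × Balanced rk r n (numEdges G) ω

upperOptimal⇔upperOptimalℕ : ∀ {n} (G : MixedGraph n) → UpperOptimal G ⇔ UpperOptimalℕ G
upperOptimal⇔upperOptimalℕ {n} G = mk⇔
  (λ (rk , r , ω , rank-H , rank-A , cc , eq) → rk , r , ω , rank-H , rank-A ,
     Equivalence.to componentCount⇔hasComponents cc , Equivalence.to (integerForm⇔balanced rk r n (numEdges G) ω) eq)
  (λ (rk , r , ω , rank-H , rank-A , C , balanced) → rk , r , ω , rank-H , rank-A ,
     Equivalence.from componentCount⇔hasComponents C , Equivalence.from (integerForm⇔balanced rk r n (numEdges G) ω) balanced)

module UpperOptimalPendant {n} (G : MixedGraph (suc (suc n))) (x y : Fin (suc (suc n))) (xy : Adj G x y)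
                           (pendant : ∀ w → Adj G x w → w ≡ y) where
  open PendantVertex G x y xy pendant

  private
    C₁ = proj₂ (hasComponents-exists G₁)

  onCycle⇔ : OnCycle G y ⇔ CycleThrough G₁ y′
  onCycle⇔ = mk⇔ (Equivalence.to cycleThrough-deletePendant ∘ onCycle⇒cycleThrough G)
                 (cycleThrough⇒onCycle G ∘ Equivalence.from cycleThrough-deletePendant)

  upperOptimalℕ-acyclic : ¬ CycleThrough G₁ y′ → UpperOptimalℕ G ⇔ UpperOptimalℕ G′
  upperOptimalℕ-acyclic ¬cycle = mk⇔ to from
    where
    components : ∀ {ω ω′} → HasComponents (Adj G) ω → HasComponents (Adj G′) ω′ → suc ω′ ≡ ω + degree G₁ y′
    components C C′ = trans (components-deleteVertex-acyclic G₁ y′ C′ C₁ ¬cycle)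
                            (cong (_+ degree G₁ y′) (components-deletePendant C C₁))
    to : UpperOptimalℕ G → UpperOptimalℕ G′
    to (rk , r , ω , rank-H , rank-A , C , balanced) =
      let rk′ , rk≡ , rank-H′ = Hermitian.hasRank⁻ rank-H
          r′ , r≡ , rank-A′   = Adjacency.hasRank⁻ rank-A
          ω′ , C′             = hasComponents-exists G′
      in rk′ , r′ , ω′ , rank-H′ , rank-A′ , C′ ,
         Equivalence.to (balanced-pendant {E′ = numEdges G′} rk≡ r≡ numEdges-pendant (components C C′)) balanced
    from : UpperOptimalℕ G′ → UpperOptimalℕ G
    from (rk′ , r′ , ω′ , rank-H′ , rank-A′ , C′ , balanced′) =
      let ω , C = hasComponents-exists G
      in 2 + rk′ , 2 + r′ , ω , Hermitian.hasRank⁺ rank-H′ , Adjacency.hasRank⁺ rank-A′ , C ,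
         Equivalence.from (balanced-pendant {ω = ω} {rk′} {r′} {numEdges G′} refl refl numEdges-pendant (components C C′))
                          balanced′

  ¬upperOptimalℕ-cycle : CycleThrough G₁ y′ → ¬ UpperOptimalℕ G
  ¬upperOptimalℕ-cycle cycle (rk , r , ω , rank-H , rank-A , C , balanced) =
    let rk′ , rk≡ , rank-H′ = Hermitian.hasRank⁻ rank-H
        r′ , r≡ , rank-A′   = Adjacency.hasRank⁻ rank-A
        ω′ , C′             = hasComponents-exists G′
    in ¬balanced-pendant-cycle {E′ = numEdges G′} rk≡ r≡ numEdges-pendant
         (subst (λ c → 2 + ω′ ≤ c + degree G₁ y′) (components-deletePendant C C₁)
                (components-deleteVertex-cycle G₁ y′ C′ C₁ cycle))
         (hasRank-bound G′ rank-H′ rank-A′ C′) balanced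

  upperOptimal-acyclic : ¬ CycleThrough G₁ y′ → UpperOptimal G ⇔ UpperOptimal G′
  upperOptimal-acyclic ¬cycle =
    ⇔-sym (upperOptimal⇔upperOptimalℕ G′) ⇔-∘ (upperOptimalℕ-acyclic ¬cycle ⇔-∘ upperOptimal⇔upperOptimalℕ G)

  ¬upperOptimal-cycle : CycleThrough G₁ y′ → ¬ UpperOptimal G
  ¬upperOptimal-cycle cycle = ¬upperOptimalℕ-cycle cycle ∘ Equivalence.to (upperOptimal⇔upperOptimalℕ G)

mainTheorem9 : ∀ {n} (G : MixedGraph (suc (suc n))) (x y : Fin (suc (suc n))) →
    (xy : Adj G x y) → (∀ v → Adj G x v → v ≡ y) →
    UpperOptimal G ⇔ ((¬ OnCycle G y) × UpperOptimal (deleteTwo G x y (adj⇒≢ G xy)))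
mainTheorem9 G x y xy pendant = mk⇔
  (λ optimal → let ¬cycle = λ cycle → ¬upperOptimal-cycle cycle optimal
               in ¬cycle ∘ Equivalence.to onCycle⇔ , Equivalence.to (upperOptimal-acyclic ¬cycle) optimal)
  (λ (¬onCycle , optimal′) → Equivalence.from (upperOptimal-acyclic (¬onCycle ∘ Equivalence.from onCycle⇔)) optimal′)
  where open UpperOptimalPendant G x y xy pendant
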